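{- Let $k\geqslant 1$. For $n,r\geqslant0$ let $f_n^r(k)$ be the number of $132$-avoiding permutations in $\mathfrak S_n$ containing exactly $r$ occurrences of $12\dots k$, and let $F_r(x;k)=\sum_{n\geqslant0}f_n^r(k)x^n$. Then for every $1\leqslant r\leqslant k(k+3)/2$, $F_r(x;k)$ is a rational function given by $$ F_r(x;k)=\frac{x^{\frac{r-1}{2}}\,U_{k-1}^{r-1}\left(\frac1{2\sqrt{x}}\right)}{U_{k}^{r+1}\left(\frac1{2\sqrt{x}}\right)}\sum_{j=0}^{\lfloor (r-1)/k\rfloor}\binom{r-kj+j-1}{j}\left(\frac{U_{k}\left(\frac1{2\sqrt{x}}\right)}{x^{\frac{k-2}{2k}}\,U_{k-1}\left(\frac1{2\sqrt{x}}\right)}\right)^{kj}, $$ where $U_m$ is the $m$th Chebyshev polynomial of the second kind, $U_m(\cos\theta)=\sin((m+1)\theta)/\sin\theta$.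
   Context: An occurrence of $12\dots k$ in $\pi\in\mathfrak S_n$ is a set of indices $i_1<\dots<i_k$ with $\pi_{i_1}<\dots<\pi_{i_k}$; $\pi$ is $132$-avoiding if there are no $i_1<i_2<i_3$ with $\pi_{i_1}<\pi_{i_3}<\pi_{i_2}$. The empty permutation is counted for $n=0$. Powers of $U_m$ are written as superscripts, e.g. $U_{k-1}^{r-1}$ is the $(r-1)$th power of $U_{k-1}$. -}

module Defs where

open import Data.Bool using (Bool; true; false; _∧_; not; if_then_else_)
open import Data.Nat as ℕ using (ℕ; zero; suc; _<ᵇ_; _≡ᵇ_; _∸_; NonZero)
open import Data.Nat.Combinatorics using (_C_)
open import Data.Nat.DivMod using (_/_)
open import Data.List using (List; []; _∷_; [_]; map; _++_; length; filterᵇ; concatMap; upTo; foldr)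
open import Data.Bool.ListAction using (any)
open import Data.Integer as ℤ using (ℤ; +_)

-- all sublists (subsequences) chosen by positions; each set of
-- indices i₁<…<iₘ contributes exactly one entry
sublists : {A : Set} → List A → List (List A)
sublists [] = [ [] ]
sublists (x ∷ xs) = map (x ∷_) (sublists xs) ++ sublists xs

incr : List ℕ → Bool
incr [] = true
incr (x ∷ []) = true
incr (x ∷ y ∷ ys) = (x <ᵇ y) ∧ incr (y ∷ ys)

is132 : List ℕ → Bool
is132 (a ∷ b ∷ c ∷ []) = (a <ᵇ c) ∧ (c <ᵇ b)
is132 _ = false

avoids132 : List ℕ → Bool
avoids132 w = not (any is132 (sublists w))

occ : ℕ → List ℕ → ℕ
occ k w = length (filterᵇ (λ s → (length s ≡ᵇ k) ∧ incr s) (sublists w))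

words : ℕ → ℕ → List (List ℕ)
words zero m = [ [] ]
words (suc n) m = concatMap (λ a → map (a ∷_) (words n m)) (upTo m)

elemᵇ : ℕ → List ℕ → Bool
elemᵇ x [] = false
elemᵇ x (y ∷ ys) = if x ≡ᵇ y then true else elemᵇ x ys

distinct : List ℕ → Bool
distinct [] = true
distinct (x ∷ xs) = not (elemᵇ x xs) ∧ distinct xs

-- 𝔖ₙ : the n! permutations of {0,…,n-1} in one-line notation
perms : ℕ → List (List ℕ)
perms n = filterᵇ distinct (words n n)

f : ℕ → ℕ → ℕ → ℕ
f n r k = length (filterᵇ (λ w → avoids132 w ∧ (occ k w ≡ᵇ r)) (perms n))

Series : Set
Series = ℕ → ℤ

sumℤ : ℕ → (ℕ → ℤ) → ℤ
sumℤ zero g = + 0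
sumℤ (suc n) g = sumℤ n g ℤ.+ g n

_⊛_ : Series → Series → Series
(a ⊛ b) n = sumℤ (suc n) (λ i → a i ℤ.* b (n ∸ i))

_⊕_ : Series → Series → Series
(a ⊕ b) n = a n ℤ.+ b n

one : Series
one zero = + 1
one (suc n) = + 0

xpow : ℕ → Series
xpow e n = if e ≡ᵇ n then + 1 else + 0

scale : ℤ → Series → Series
scale c a n = c ℤ.* a n

_^ˢ_ : Series → ℕ → Series
a ^ˢ zero = one
a ^ˢ suc m = a ⊛ (a ^ˢ m)

shift : Series → Series
shift a zero = + 0
shift a (suc n) = a n

-- R m = x^{m/2} U_m(1/(2√x)), U_m the Chebyshev polynomial of the 2nd kind.
-- From U_0 = 1, U_1(t) = 2t, U_{m+2}(t) = 2t U_{m+1}(t) - U_m(t) one gets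
-- R 0 = R 1 = 1 and R (m+2) = R (m+1) - x · R m (a polynomial in x).
R : ℕ → Series
R zero = one
R (suc zero) = one
R (suc (suc m)) n = R (suc m) n ℤ.- shift (R m) n

F : ℕ → ℕ → Series
F r k n = + f n r k

-- Numerator after clearing U_k^{r+1}: the right-hand side of the theorem
-- multiplied by R_k^{r+1} equals
--   ∑_{j=0}^{⌊(r-1)/k⌋} C(r-kj+j-1, j) x^{r+k-1-(k-1)j} R_{k-1}^{r-1-kj} R_k^{kj}
term : ℕ → ℕ → ℕ → Series
term r k j =
  scale (+ ((((r ∸ 1) ∸ k ℕ.* j) ℕ.+ j) C j))
    (xpow ((r ℕ.+ k ∸ 1) ∸ (k ∸ 1) ℕ.* j)
      ⊛ ((R (k ∸ 1) ^ˢ ((r ∸ 1) ∸ k ℕ.* j)) ⊛ (R k ^ˢ (k ℕ.* j))))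

sumS : ℕ → (ℕ → Series) → Series
sumS zero g n = + 0
sumS (suc m) g n = sumS m g n ℤ.+ g m n

numer : (r k : ℕ) → .{{NonZero k}} → Series
numer r k = sumS (suc ((r ∸ 1) / k)) (term r k)

{-# OPTIONS --safe #-}
-- A binary tree t gives the 132-avoiding permutation toPerm t (in-order, root largest, left
-- subtree above right subtree), and every 132-avoiding permutation arises exactly once. The
-- occurrences of 12…k then become a weight: a node with d left edges above it starts C(d, k-1)
-- of them. Counting left edges from an offset d, the generating functions G_d(x, q) of trees by
-- size and weight satisfy G_d = 1 + x q^{C(d,k-1)} G_{d+1} G_d: a continued fraction whose first
-- k-1 levels are free of q, with convergents given by the continuants R_m = x^{m/2} U_m(1/(2√x)).
-- For E = R_k G_0 - R_{k-1}, Cassini's identity and G_{k+1} ≡ 1 (mod q^{C(k+1,2)}) give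
--   E (R_k (1 - x q^k) - x q R_{k-1}) ≡ x^k q   (mod q^{1+k+C(k+1,2)}).
-- Comparing coefficients of q^r, the rescaled P_r = R_k^r E_r satisfy
--   P_r = [r = 1] x^k + x R_{k-1} P_{r-1} + x R_k^k P_{r-k},
-- as do the binomial sums of the theorem, by Pascal's rule; the recursion has a unique solution,
-- and R_k^{r+1} F_r = R_k^r E_r for r ≥ 1.
module Submission where

module Sums where

  open import Algebra.Bundles using (CommutativeSemiring)
  open import Level using (Level)
  open import Data.Nat as ℕ using (ℕ; zero; suc; _∸_; _<_; _≤_)
  import Data.Nat.Properties as ℕₚ
  open import Data.List using (List; []; _∷_; _++_; map; concatMap; upTo)
  import Data.List.Properties as Listₚ
  open import Data.List.Relation.Binary.Permutation.Propositional as ↭ using (_↭_; prep; swap)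
  open import Function using (_∘_)
  import Relation.Binary.PropositionalEquality as ≡

  module FiniteSum {c ℓ} (R : CommutativeSemiring c ℓ) where

    open CommutativeSemiring R
    open import Relation.Binary.Reasoning.Setoid setoid
    open import Algebra.Properties.CommutativeSemigroup +-commutativeSemigroup using (interchange)

    ∑ : ℕ → (ℕ → Carrier) → Carrier
    ∑ zero g = 0#
    ∑ (suc n) g = ∑ n g + g n

    ∑-cong-< : ∀ n {g h} → (∀ i → i < n → g i ≈ h i) → ∑ n g ≈ ∑ n h
    ∑-cong-< zero e = refl
    ∑-cong-< (suc n) e = +-cong (∑-cong-< n (λ i i<n → e i (ℕₚ.m≤n⇒m≤1+n i<n))) (e n ℕₚ.≤-refl)

    ∑-cong : ∀ n {g h} → (∀ i → g i ≈ h i) → ∑ n g ≈ ∑ n h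
    ∑-cong n e = ∑-cong-< n (λ i _ → e i)

    ∑-0# : ∀ n {g} → (∀ i → i < n → g i ≈ 0#) → ∑ n g ≈ 0#
    ∑-0# n e = trans (∑-cong-< n e) (zeros n)
      where
      zeros : ∀ n → ∑ n (λ _ → 0#) ≈ 0#
      zeros zero = refl
      zeros (suc n) = trans (+-identityʳ _) (zeros n)

    ∑-distrib-+ : ∀ n g h → ∑ n (λ i → g i + h i) ≈ ∑ n g + ∑ n h
    ∑-distrib-+ zero g h = sym (+-identityˡ 0#)
    ∑-distrib-+ (suc n) g h = begin
      ∑ n (λ i → g i + h i) + (g n + h n) ≈⟨ +-congʳ (∑-distrib-+ n g h) ⟩
      (∑ n g + ∑ n h) + (g n + h n)       ≈⟨ interchange _ _ _ _ ⟩
      (∑ n g + g n) + (∑ n h + h n)       ∎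

    *-distribˡ-∑ : ∀ n a g → a * ∑ n g ≈ ∑ n (λ i → a * g i)
    *-distribˡ-∑ zero a g = zeroʳ a
    *-distribˡ-∑ (suc n) a g = trans (distribˡ a (∑ n g) (g n)) (+-congʳ (*-distribˡ-∑ n a g))

    *-distribʳ-∑ : ∀ n a g → ∑ n g * a ≈ ∑ n (λ i → g i * a)
    *-distribʳ-∑ n a g = trans (*-comm _ a) (trans (*-distribˡ-∑ n a g) (∑-cong n (λ i → *-comm a (g i))))

    ∑-sucˡ : ∀ n g → ∑ (suc n) g ≈ g 0 + ∑ n (g ∘ suc)
    ∑-sucˡ zero g = trans (+-identityˡ _) (sym (+-identityʳ _))
    ∑-sucˡ (suc n) g = trans (+-congʳ (∑-sucˡ n g)) (+-assoc _ _ _)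

    ∑-reverse : ∀ n g → ∑ n g ≈ ∑ n (λ i → g (n ∸ suc i))
    ∑-reverse zero g = refl
    ∑-reverse (suc n) g = begin
      ∑ n g + g n                     ≈⟨ +-congʳ (∑-reverse n g) ⟩
      ∑ n (λ i → g (n ∸ suc i)) + g n ≈⟨ +-comm _ _ ⟩
      g n + ∑ n (λ i → g (n ∸ suc i)) ≈⟨ sym (∑-sucˡ n (λ i → g (n ∸ i))) ⟩
      ∑ (suc n) (λ i → g (n ∸ i))     ∎

    ∑-comm : ∀ m n (h : ℕ → ℕ → Carrier) → ∑ m (λ i → ∑ n (h i)) ≈ ∑ n (λ a → ∑ m (λ i → h i a))
    ∑-comm zero n h = sym (∑-0# n (λ _ _ → refl))
    ∑-comm (suc m) n h = trans (+-congʳ (∑-comm m n h)) (sym (∑-distrib-+ n (λ a → ∑ m (λ i → h i a)) (h m)))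

    ∑-triangle : ∀ n (f : ℕ → ℕ → Carrier) →
      ∑ (suc n) (λ l → ∑ (suc l) (λ i → f i l)) ≈ ∑ (suc n) (λ i → ∑ (suc (n ∸ i)) (λ j → f i (i ℕ.+ j)))
    ∑-triangle zero f = refl
    ∑-triangle (suc n) f = begin
      ∑ (suc n) (λ l → ∑ (suc l) (λ i → f i l)) + (∑ (suc n) (λ i → f i (suc n)) + f (suc n) (suc n))
        ≈⟨ +-congʳ (∑-triangle n f) ⟩
      ∑ (suc n) column + (∑ (suc n) (λ i → f i (suc n)) + f (suc n) (suc n))
        ≈⟨ sym (+-assoc _ _ _) ⟩
      (∑ (suc n) column + ∑ (suc n) (λ i → f i (suc n))) + f (suc n) (suc n)
        ≈⟨ +-cong (sym (∑-distrib-+ (suc n) _ _)) (sym (+-identityˡ _)) ⟩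
      ∑ (suc n) (λ i → column i + f i (suc n)) + (0# + f (suc n) (suc n))
        ≈⟨ +-cong (∑-cong-< (suc n) (λ i i≤n → extend i (ℕₚ.≤-pred i≤n))) lastColumn ⟩
      ∑ (suc n) (λ i → ∑ (suc (suc n ∸ i)) (λ j → f i (i ℕ.+ j))) + ∑ (suc (n ∸ n)) (λ j → f (suc n) (suc n ℕ.+ j)) ∎
      where
      column : ℕ → Carrier
      column i = ∑ (suc (n ∸ i)) (λ j → f i (i ℕ.+ j))
      extend : ∀ i → i ≤ n → column i + f i (suc n) ≈ ∑ (suc (suc n ∸ i)) (λ j → f i (i ℕ.+ j))
      extend i i≤n rewrite ℕₚ.+-∸-assoc 1 i≤n =
        +-congˡ (reflexive (≡.cong (f i) (≡.sym (≡.trans (ℕₚ.+-suc i (n ∸ i)) (≡.cong suc (ℕₚ.m+[n∸m]≡n i≤n))))))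
      lastColumn : 0# + f (suc n) (suc n) ≈ ∑ (suc (n ∸ n)) (λ j → f (suc n) (suc n ℕ.+ j))
      lastColumn rewrite ℕₚ.n∸n≡0 n | ℕₚ.+-identityʳ n = refl

    private variable
      a : Level
      A B : Set a

    ∑ₗ : List A → (A → Carrier) → Carrier
    ∑ₗ [] f = 0#
    ∑ₗ (x ∷ xs) f = f x + ∑ₗ xs f

    ∑ₗ-cong : ∀ (xs : List A) {f g} → (∀ x → f x ≈ g x) → ∑ₗ xs f ≈ ∑ₗ xs g
    ∑ₗ-cong [] e = refl
    ∑ₗ-cong (x ∷ xs) e = +-cong (e x) (∑ₗ-cong xs e)

    ∑ₗ-++ : ∀ (xs ys : List A) f → ∑ₗ (xs ++ ys) f ≈ ∑ₗ xs f + ∑ₗ ys f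
    ∑ₗ-++ [] ys f = sym (+-identityˡ _)
    ∑ₗ-++ (x ∷ xs) ys f = trans (+-congˡ (∑ₗ-++ xs ys f)) (sym (+-assoc _ _ _))

    ∑ₗ-map : ∀ (g : A → B) xs f → ∑ₗ (map g xs) f ≈ ∑ₗ xs (f ∘ g)
    ∑ₗ-map g [] f = refl
    ∑ₗ-map g (x ∷ xs) f = +-congˡ (∑ₗ-map g xs f)

    ∑ₗ-concatMap : ∀ (g : A → List B) xs f → ∑ₗ (concatMap g xs) f ≈ ∑ₗ xs (λ x → ∑ₗ (g x) f)
    ∑ₗ-concatMap g [] f = refl
    ∑ₗ-concatMap g (x ∷ xs) f = trans (∑ₗ-++ (g x) (concatMap g xs) f) (+-congˡ (∑ₗ-concatMap g xs f))

    *-distribˡ-∑ₗ : ∀ (xs : List A) c f → c * ∑ₗ xs f ≈ ∑ₗ xs (λ x → c * f x)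
    *-distribˡ-∑ₗ [] c f = zeroʳ c
    *-distribˡ-∑ₗ (x ∷ xs) c f = trans (distribˡ c _ _) (+-congˡ (*-distribˡ-∑ₗ xs c f))

    *-distribʳ-∑ₗ : ∀ (xs : List A) c f → ∑ₗ xs f * c ≈ ∑ₗ xs (λ x → f x * c)
    *-distribʳ-∑ₗ xs c f = trans (*-comm _ c) (trans (*-distribˡ-∑ₗ xs c f) (∑ₗ-cong xs (λ x → *-comm c (f x))))

    ∑ₗ-↭ : ∀ {xs ys : List A} f → xs ↭ ys → ∑ₗ xs f ≈ ∑ₗ ys f
    ∑ₗ-↭ f ↭.refl = refl
    ∑ₗ-↭ f (prep x p) = +-congˡ (∑ₗ-↭ f p)
    ∑ₗ-↭ f (swap x y p) = begin
      f x + (f y + _) ≈⟨ sym (+-assoc _ _ _) ⟩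
      (f x + f y) + _ ≈⟨ +-cong (+-comm _ _) (∑ₗ-↭ f p) ⟩
      (f y + f x) + _ ≈⟨ +-assoc _ _ _ ⟩
      f y + (f x + _) ∎
    ∑ₗ-↭ f (↭.trans p q) = trans (∑ₗ-↭ f p) (∑ₗ-↭ f q)

    ∑ₗ-upTo : ∀ n f → ∑ₗ (upTo n) f ≈ ∑ n f
    ∑ₗ-upTo zero f = refl
    ∑ₗ-upTo (suc n) f = begin
      ∑ₗ (upTo (suc n)) f      ≡⟨ ≡.cong (λ xs → ∑ₗ xs f) (≡.sym (Listₚ.upTo-∷ʳ n)) ⟩
      ∑ₗ (upTo n ++ n ∷ []) f  ≈⟨ ∑ₗ-++ (upTo n) (n ∷ []) f ⟩
      ∑ₗ (upTo n) f + (f n + 0#) ≈⟨ +-cong (∑ₗ-upTo n f) (+-identityʳ _) ⟩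
      ∑ n f + f n ∎

module FormalPowerSeries where

  open import Algebra.Bundles using (CommutativeRing; RawRing)
  open import Algebra.Structures using (IsCommutativeRing)
  open import Algebra.Solver.Ring.AlmostCommutativeRing using (fromCommutativeRing; _-Raw-AlmostCommutative⟶_)
  open import Data.Nat as ℕ using (ℕ; zero; suc; _∸_; _<_; s≤s)
  import Data.Nat.Properties as ℕₚ
  open import Data.Product using (_,_)
  open import Level using (_⊔_)
  open import Relation.Binary.Structures using (IsEquivalence)
  import Relation.Binary.PropositionalEquality as ≡
  open import Relation.Nullary using (yes; no)
  open import Data.Sum using (inj₁; inj₂)
  open Sums using (module FiniteSum)

  module PowerSeries {c ℓ} (R : CommutativeRing c ℓ) where

    open CommutativeRing R hiding (zero)
    open FiniteSum commutativeSemiring public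
    open import Relation.Binary.Reasoning.Setoid setoid
    open import Algebra.Properties.AbelianGroup +-abelianGroup using (ε⁻¹≈ε)
    open import Algebra.Properties.Semiring.Exp semiring using () renaming (_^_ to _^ᶜ_)

    Series : Set c
    Series = ℕ → Carrier

    infix 4 _≋_
    infixl 7 _✶_
    infixl 6 _⊞_

    _≋_ : Series → Series → Set ℓ
    a ≋ b = ∀ n → a n ≈ b n

    _⊞_ : Series → Series → Series
    (a ⊞ b) n = a n + b n

    ⊟_ : Series → Series
    (⊟ a) n = - a n

    𝟘 : Series
    𝟘 n = 0#

    ι : Carrier → Series
    ι a zero = a
    ι a (suc n) = 0#

    𝟙 : Series
    𝟙 = ι 1#

    shift : Series → Series
    shift a zero = 0#
    shift a (suc n) = a n

    X : Series
    X = shift 𝟙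

    shiftBy : ℕ → Series → Series
    shiftBy zero a = a
    shiftBy (suc m) a = shift (shiftBy m a)

    -- Opaque, so that unification never unfolds products; ✶-unfold exposes the definition.
    opaque
      _✶_ : Series → Series → Series
      (a ✶ b) n = ∑ (suc n) (λ i → a i * b (n ∸ i))

      ✶-unfold : ∀ a b n → (a ✶ b) n ≡.≡ ∑ (suc n) (λ i → a i * b (n ∸ i))
      ✶-unfold a b n = ≡.refl

      ✶-comm : ∀ a b → a ✶ b ≋ b ✶ a
      ✶-comm a b n = begin
        ∑ (suc n) (λ i → a i * b (n ∸ i))             ≈⟨ ∑-reverse (suc n) _ ⟩
        ∑ (suc n) (λ i → a (n ∸ i) * b (n ∸ (n ∸ i)))
          ≈⟨ ∑-cong-< (suc n) (λ i i≤n → trans (*-comm _ _) (*-congʳ (reflexive (≡.cong b (ℕₚ.m∸[m∸n]≡n (ℕₚ.≤-pred i≤n)))))) ⟩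
        ∑ (suc n) (λ i → b i * a (n ∸ i))             ∎

      ✶-cong : ∀ {a a′ b b′} → a ≋ a′ → b ≋ b′ → a ✶ b ≋ a′ ✶ b′
      ✶-cong ea eb n = ∑-cong (suc n) (λ i → *-cong (ea i) (eb (n ∸ i)))

      ι✶ : ∀ a b → ι a ✶ b ≋ (λ n → a * b n)
      ι✶ a b n = begin
        ∑ (suc n) (λ i → ι a i * b (n ∸ i))  ≈⟨ ∑-sucˡ n _ ⟩
        a * b n + ∑ n (λ i → 0# * b (n ∸ suc i)) ≈⟨ +-congˡ (∑-0# n (λ i _ → zeroˡ _)) ⟩
        a * b n + 0#                         ≈⟨ +-identityʳ _ ⟩
        a * b n                              ∎

      X✶ : ∀ a → X ✶ a ≋ shift a
      X✶ a zero = trans (+-identityˡ _) (zeroˡ _)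
      X✶ a (suc n) = begin
        ∑ (suc (suc n)) (λ i → X i * a (suc n ∸ i))   ≈⟨ ∑-sucˡ (suc n) _ ⟩
        0# * a (suc n) + ∑ (suc n) (λ i → X (suc i) * a (n ∸ i)) ≈⟨ trans (+-congʳ (zeroˡ _)) (+-identityˡ _) ⟩
        ∑ (suc n) (λ i → ι 1# i * a (n ∸ i))           ≈⟨ ι✶ 1# a n ⟩
        1# * a n                                      ≈⟨ *-identityˡ _ ⟩
        a n                                           ∎

      ✶-distribˡ : ∀ a b c → a ✶ (b ⊞ c) ≋ a ✶ b ⊞ a ✶ c
      ✶-distribˡ a b c n = trans (∑-cong (suc n) (λ i → distribˡ _ _ _)) (∑-distrib-+ (suc n) _ _)

      ✶-assoc : ∀ a b c → (a ✶ b) ✶ c ≋ a ✶ (b ✶ c)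
      ✶-assoc a b c n = begin
        ∑ (suc n) (λ l → ∑ (suc l) (λ i → a i * b (l ∸ i)) * c (n ∸ l))
          ≈⟨ ∑-cong (suc n) (λ l → *-distribʳ-∑ (suc l) _ _) ⟩
        ∑ (suc n) (λ l → ∑ (suc l) (λ i → a i * b (l ∸ i) * c (n ∸ l)))
          ≈⟨ ∑-triangle n _ ⟩
        ∑ (suc n) (λ i → ∑ (suc (n ∸ i)) (λ j → a i * b ((i ℕ.+ j) ∸ i) * c (n ∸ (i ℕ.+ j))))
          ≈⟨ ∑-cong (suc n) (λ i → ∑-cong (suc (n ∸ i)) (λ j → trans (*-assoc _ _ _) (*-congˡ (reindex i j)))) ⟩
        ∑ (suc n) (λ i → ∑ (suc (n ∸ i)) (λ j → a i * (b j * c ((n ∸ i) ∸ j))))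
          ≈⟨ ∑-cong (suc n) (λ i → sym (*-distribˡ-∑ (suc (n ∸ i)) _ _)) ⟩
        ∑ (suc n) (λ i → a i * ∑ (suc (n ∸ i)) (λ j → b j * c ((n ∸ i) ∸ j))) ∎
        where
        reindex : ∀ i j → b ((i ℕ.+ j) ∸ i) * c (n ∸ (i ℕ.+ j)) ≈ b j * c ((n ∸ i) ∸ j)
        reindex i j = *-cong (reflexive (≡.cong b (ℕₚ.m+n∸m≡n i j))) (reflexive (≡.cong c (≡.sym (ℕₚ.∸-+-assoc n i j))))

    ✶-identityˡ : ∀ a → 𝟙 ✶ a ≋ a
    ✶-identityˡ a n = trans (ι✶ 1# a n) (*-identityˡ _)

    ✶-identityʳ : ∀ a → a ✶ 𝟙 ≋ a
    ✶-identityʳ a n = trans (✶-comm a 𝟙 n) (✶-identityˡ a n)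

    ✶-distribʳ : ∀ a b c → (b ⊞ c) ✶ a ≋ b ✶ a ⊞ c ✶ a
    ✶-distribʳ a b c n = trans (✶-comm (b ⊞ c) a n) (trans (✶-distribˡ a b c n) (+-cong (✶-comm a b n) (✶-comm a c n)))

    ⊞-cong : ∀ {a a′ b b′} → a ≋ a′ → b ≋ b′ → a ⊞ b ≋ a′ ⊞ b′
    ⊞-cong ea eb n = +-cong (ea n) (eb n)

    ⊞-congˡ : ∀ a {b b′} → b ≋ b′ → a ⊞ b ≋ a ⊞ b′
    ⊞-congˡ a = ⊞-cong {a} (λ n → refl)

    ⊞-congʳ : ∀ {a a′} b → a ≋ a′ → a ⊞ b ≋ a′ ⊞ b
    ⊞-congʳ b e = ⊞-cong {b = b} e (λ n → refl)

    ✶-congˡ : ∀ a {b b′} → b ≋ b′ → a ✶ b ≋ a ✶ b′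
    ✶-congˡ a e = ✶-cong {a = a} (λ n → refl) e

    ✶-congʳ : ∀ {a a′} b → a ≋ a′ → a ✶ b ≋ a′ ✶ b
    ✶-congʳ b e = ✶-cong {b = b} e (λ n → refl)

    ≋-isEquivalence : IsEquivalence _≋_
    ≋-isEquivalence = record
      { refl = λ n → refl
      ; sym = λ e n → sym (e n)
      ; trans = λ e f n → trans (e n) (f n)
      }

    series-isCommutativeRing : IsCommutativeRing _≋_ _⊞_ _✶_ ⊟_ 𝟘 𝟙
    series-isCommutativeRing = record
      { isRing = record
        { +-isAbelianGroup = record
          { isGroup = record
            { isMonoid = record
              { isSemigroup = record
                { isMagma = record { isEquivalence = ≋-isEquivalence ; ∙-cong = λ e f n → +-cong (e n) (f n) }
                ; assoc = λ a b c n → +-assoc (a n) (b n) (c n)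
                }
              ; identity = (λ a n → +-identityˡ (a n)) , (λ a n → +-identityʳ (a n))
              }
            ; inverse = (λ a n → -‿inverseˡ (a n)) , (λ a n → -‿inverseʳ (a n))
            ; ⁻¹-cong = λ e n → -‿cong (e n)
            }
          ; comm = λ a b n → +-comm (a n) (b n)
          }
        ; *-cong = ✶-cong
        ; *-assoc = ✶-assoc
        ; *-identity = ✶-identityˡ , ✶-identityʳ
        ; distrib = ✶-distribˡ , ✶-distribʳ
        }
      ; *-comm = ✶-comm
      }

    seriesRing : CommutativeRing c ℓ
    seriesRing = record { isCommutativeRing = series-isCommutativeRing }

    ι-cong : ∀ {a b} → a ≈ b → ι a ≋ ι b
    ι-cong e zero = e
    ι-cong e (suc n) = refl

    ι-+ : ∀ a b → ι (a + b) ≋ ι a ⊞ ι b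
    ι-+ a b zero = refl
    ι-+ a b (suc n) = sym (+-identityˡ 0#)

    ι-* : ∀ a b → ι (a * b) ≋ ι a ✶ ι b
    ι-* a b zero = sym (ι✶ a (ι b) zero)
    ι-* a b (suc n) = sym (trans (ι✶ a (ι b) (suc n)) (zeroʳ a))

    ι-neg : ∀ a → ι (- a) ≋ ⊟ ι a
    ι-neg a zero = refl
    ι-neg a (suc n) = sym ε⁻¹≈ε

    ι-0# : ι 0# ≋ 𝟘
    ι-0# zero = refl
    ι-0# (suc n) = refl

    -- The constant embedding lifts a ring solver for R to one for its series.
    liftMorphism : ∀ {Coeff : RawRing c ℓ} → Coeff -Raw-AlmostCommutative⟶ fromCommutativeRing R →
                   Coeff -Raw-AlmostCommutative⟶ fromCommutativeRing seriesRing
    liftMorphism φ = record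
      { ⟦_⟧ = λ a → ι ⟦ a ⟧
      ; +-homo = λ a b n → trans (ι-cong (+-homo a b) n) (ι-+ _ _ n)
      ; *-homo = λ a b n → trans (ι-cong (*-homo a b) n) (ι-* _ _ n)
      ; -‿homo = λ a n → trans (ι-cong (-‿homo a) n) (ι-neg _ n)
      ; 0-homo = λ n → trans (ι-cong 0-homo n) (ι-0# n)
      ; 1-homo = ι-cong 1-homo
      }
      where open _-Raw-AlmostCommutative⟶_ φ

    open import Algebra.Properties.Semiring.Exp (CommutativeRing.semiring seriesRing) public
      using (_^_; ^-homo-*)

    shift-cong : ∀ {a b} → a ≋ b → shift a ≋ shift b
    shift-cong e zero = refl
    shift-cong e (suc n) = e n

    shiftBy-high : ∀ m a r → shiftBy m a (m ℕ.+ r) ≈ a r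
    shiftBy-high zero a r = refl
    shiftBy-high (suc m) a r = shiftBy-high m a r

    powX✶ : ∀ m a → X ^ m ✶ a ≋ shiftBy m a
    powX✶ zero a = ✶-identityˡ a
    powX✶ (suc m) a n = trans (✶-assoc X (X ^ m) a n) (trans (X✶ _ n) (shift-cong (powX✶ m a) n))

    infix 4 X^_∣_
    X^_∣_ : ℕ → Series → Set ℓ
    X^ m ∣ a = ∀ i → i < m → a i ≈ 0#

    X^∣-shiftBy : ∀ m a → X^ m ∣ shiftBy m a
    X^∣-shiftBy (suc m) a zero r<m = refl
    X^∣-shiftBy (suc m) a (suc r) (s≤s r<m) = X^∣-shiftBy m a r r<m

    X^0∣ : ∀ a → X^ 0 ∣ a
    X^0∣ a i ()

    X^∣-resp-≋ : ∀ {m a b} → a ≋ b → X^ m ∣ a → X^ m ∣ b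
    X^∣-resp-≋ e d i i<m = trans (sym (e i)) (d i i<m)

    X^∣-✶ : ∀ {m l a b} → X^ m ∣ a → X^ l ∣ b → X^ (m ℕ.+ l) ∣ a ✶ b
    X^∣-✶ {m} {l} {a} {b} da db n n<m+l = trans (reflexive (✶-unfold a b n)) (∑-0# (suc n) vanishing)
      where
      vanishing : ∀ i → i < suc n → a i * b (n ∸ i) ≈ 0#
      vanishing i i≤n with i ℕ.<? m
      ... | yes i<m = trans (*-congʳ (da i i<m)) (zeroˡ _)
      ... | no i≮m = trans (*-congˡ (db (n ∸ i) n∸i<l)) (zeroʳ _)
        where
        n∸i<l : n ∸ i < l
        n∸i<l = ℕₚ.+-cancelˡ-< i (n ∸ i) l (ℕₚ.<-≤-trans
          (≡.subst (_< m ℕ.+ l) (≡.sym (ℕₚ.m+[n∸m]≡n (ℕₚ.≤-pred i≤n))) n<m+l) (ℕₚ.+-monoˡ-≤ l (ℕₚ.≮⇒≥ i≮m)))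

    X^≋shiftBy : ∀ m → X ^ m ≋ shiftBy m 𝟙
    X^≋shiftBy m n = trans (sym (✶-identityʳ (X ^ m) n)) (powX✶ m 𝟙 n)

    X^m∣X^m : ∀ m → X^ m ∣ X ^ m
    X^m∣X^m m i i<m = trans (X^≋shiftBy m i) (X^∣-shiftBy m 𝟙 i i<m)

    ι-^ : ∀ a m → ι (a ^ᶜ m) ≋ ι a ^ m
    ι-^ a zero n = refl
    ι-^ a (suc m) n = trans (ι-* a (a ^ᶜ m) n) (✶-congˡ (ι a) (ι-^ a m) n)

    -- Rescaling the variable by c commutes with multiplication by X^m.
    ^ᶜ-shiftBy : ∀ c m a p → c ^ᶜ p * shiftBy m a p ≈ c ^ᶜ m * shiftBy m (λ i → c ^ᶜ i * a i) p
    ^ᶜ-shiftBy c zero a p = sym (*-identityˡ _)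
    ^ᶜ-shiftBy c (suc m) a zero = trans (zeroʳ _) (sym (zeroʳ _))
    ^ᶜ-shiftBy c (suc m) a (suc p) = begin
      (c * c ^ᶜ p) * shiftBy m a p                    ≈⟨ *-assoc _ _ _ ⟩
      c * (c ^ᶜ p * shiftBy m a p)                    ≈⟨ *-congˡ (^ᶜ-shiftBy c m a p) ⟩
      c * (c ^ᶜ m * shiftBy m (λ i → c ^ᶜ i * a i) p) ≈⟨ sym (*-assoc _ _ _) ⟩
      (c * c ^ᶜ m) * shiftBy m (λ i → c ^ᶜ i * a i) p ∎

    AgreeBelow : ℕ → Series → Series → Set ℓ
    AgreeBelow r a b = ∀ i → i < r → a i ≈ b i

    Causal : (Series → Series) → Set (c ⊔ ℓ)
    Causal F = ∀ a b r → AgreeBelow r a b → F a r ≈ F b r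

    causal-unique : ∀ {F} → Causal F → ∀ N {a b} → AgreeBelow N a (F a) → AgreeBelow N b (F b) → AgreeBelow N a b
    causal-unique F-causal zero ha hb i ()
    causal-unique {F} F-causal (suc N) {a} {b} ha hb r r≤N with ℕₚ.m≤n⇒m<n∨m≡n (ℕₚ.≤-pred r≤N)
    ... | inj₁ r<N = agree r r<N
      where
      agree : AgreeBelow N a b
      agree = causal-unique F-causal N (λ i i<N → ha i (ℕₚ.m≤n⇒m≤1+n i<N)) (λ i i<N → hb i (ℕₚ.m≤n⇒m≤1+n i<N))
    ... | inj₂ ≡.refl = trans (ha r r≤N) (trans (F-causal a b r agree) (sym (hb r r≤N)))
      where
      agree : AgreeBelow r a b
      agree = causal-unique F-causal r (λ i i<r → ha i (ℕₚ.m≤n⇒m≤1+n i<r)) (λ i i<r → hb i (ℕₚ.m≤n⇒m≤1+n i<r))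

    shift-causal : ∀ {r a b} → AgreeBelow r a b → shift a r ≈ shift b r
    shift-causal {zero} e = refl
    shift-causal {suc r} e = e r ℕₚ.≤-refl

    shiftBy-causal : ∀ m {r a b} → AgreeBelow r a b → shiftBy (suc m) a r ≈ shiftBy (suc m) b r
    shiftBy-causal zero e = shift-causal e
    shiftBy-causal (suc m) {zero} e = refl
    shiftBy-causal (suc m) {suc r} e = shiftBy-causal m (λ i i<r → e i (ℕₚ.m≤n⇒m≤1+n i<r))

  module Transpose {c ℓ} (R : CommutativeRing c ℓ) where

    module P = PowerSeries R
    module PP = PowerSeries P.seriesRing
    open CommutativeRing R using (_≈_; _+_; _*_; refl; sym; trans; reflexive)
    open import Relation.Binary.Reasoning.Setoid (CommutativeRing.setoid R)

    ᵀ : PP.Series → PP.Series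
    ᵀ a r n = a n r

    ∑-eval : ∀ J f r → PP.∑ J f r ≡.≡ P.∑ J (λ i → f i r)
    ∑-eval zero f r = ≡.refl
    ∑-eval (suc J) f r = ≡.cong (_+ f J r) (∑-eval J f r)

    ✶-double : ∀ a b n r → (a PP.✶ b) n r ≈ P.∑ (suc n) (λ i → P.∑ (suc r) (λ v → a i v * b (n ∸ i) (r ∸ v)))
    ✶-double a b n r = begin
      (a PP.✶ b) n r                                ≡⟨ ≡.cong (λ f → f r) (PP.✶-unfold a b n) ⟩
      PP.∑ (suc n) (λ i → a i P.✶ b (n ∸ i)) r       ≡⟨ ∑-eval (suc n) _ r ⟩
      P.∑ (suc n) (λ i → (a i P.✶ b (n ∸ i)) r)      ≈⟨ P.∑-cong (suc n) (λ i → reflexive (P.✶-unfold (a i) (b (n ∸ i)) r)) ⟩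
      P.∑ (suc n) (λ i → P.∑ (suc r) (λ v → a i v * b (n ∸ i) (r ∸ v))) ∎

    ᵀ-✶ : ∀ a b → ᵀ (a PP.✶ b) PP.≋ ᵀ a PP.✶ ᵀ b
    ᵀ-✶ a b r n = trans (✶-double a b n r) (trans (P.∑-comm (suc n) (suc r) _) (sym (✶-double (ᵀ a) (ᵀ b) r n)))

    ᵀ-cong : ∀ {a b} → a PP.≋ b → ᵀ a PP.≋ ᵀ b
    ᵀ-cong e r n = e n r

    ᵀ-𝟙 : ᵀ PP.𝟙 PP.≋ PP.𝟙
    ᵀ-𝟙 zero zero = refl
    ᵀ-𝟙 zero (suc n) = refl
    ᵀ-𝟙 (suc r) zero = refl
    ᵀ-𝟙 (suc r) (suc n) = refl

    ᵀ-X : ᵀ PP.X PP.≋ PP.ι P.X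
    ᵀ-X zero zero = refl
    ᵀ-X zero (suc zero) = refl
    ᵀ-X zero (suc (suc n)) = refl
    ᵀ-X (suc r) zero = refl
    ᵀ-X (suc r) (suc zero) = refl
    ᵀ-X (suc r) (suc (suc n)) = refl

    ᵀ-ι-shiftBy : ∀ m → ᵀ (PP.ι (P.shiftBy m P.𝟙)) PP.≋ PP.shiftBy m PP.𝟙
    ᵀ-ι-shiftBy zero = ᵀ-𝟙
    ᵀ-ι-shiftBy (suc m) zero zero = refl
    ᵀ-ι-shiftBy (suc m) zero (suc n) = refl
    ᵀ-ι-shiftBy (suc m) (suc r) zero = ᵀ-ι-shiftBy m r zero
    ᵀ-ι-shiftBy (suc m) (suc r) (suc n) = ᵀ-ι-shiftBy m r (suc n)

    ᵀ-ι-X^ : ∀ m → ᵀ (PP.ι (P.X P.^ m)) PP.≋ PP.X PP.^ m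
    ᵀ-ι-X^ m r n = trans (ᵀ-cong (PP.ι-cong (P.X^≋shiftBy m)) r n) (trans (ᵀ-ι-shiftBy m r n) (sym (PP.X^≋shiftBy m r n)))

module IntegerAlgebra where

  open import Algebra.Bundles using (CommutativeRing; RawRing)
  open import Algebra.Solver.Ring.AlmostCommutativeRing
    using (AlmostCommutativeRing; fromCommutativeRing; _-Raw-AlmostCommutative⟶_; -raw-almostCommutative⟶; Induced-equivalence)
  open import Data.Integer as ℤ using (ℤ)
  open import Data.Integer.Properties using (+-*-commutativeRing)
  open import Data.Maybe using (just; nothing)
  open import Level using (0ℓ)
  open import Relation.Binary.Definitions using (WeaklyDecidable)
  open import Relation.Binary.PropositionalEquality using (refl)
  open import Relation.Nullary using (yes; no)
  open FormalPowerSeries using (module PowerSeries)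

  ℤ-rawRing : RawRing 0ℓ 0ℓ
  ℤ-rawRing = AlmostCommutativeRing.rawRing (fromCommutativeRing +-*-commutativeRing)

  -- A commutative ring with what the ring solver needs to use integer coefficients in it.
  record ℤ-Algebra : Set₁ where
    field
      ring : CommutativeRing 0ℓ 0ℓ
      embed : ℤ-rawRing -Raw-AlmostCommutative⟶ fromCommutativeRing ring
      embed-equal? : WeaklyDecidable (Induced-equivalence embed)

    open import Algebra.Solver.Ring ℤ-rawRing (fromCommutativeRing ring) embed embed-equal? public

  ℤ-algebra : ℤ-Algebra
  ℤ-algebra = record
    { ring = +-*-commutativeRing
    ; embed = -raw-almostCommutative⟶ (fromCommutativeRing +-*-commutativeRing)
    ; embed-equal? = equal?
    }
    where
    equal? : WeaklyDecidable _
    equal? a b with a ℤ.≟ b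
    ... | yes refl = just refl
    ... | no _ = nothing

  seriesAlgebra : ℤ-Algebra → ℤ-Algebra
  seriesAlgebra A = record
    { ring = seriesRing
    ; embed = liftMorphism embed
    ; embed-equal? = equal?
    }
    where
    open ℤ-Algebra A using (ring; embed; embed-equal?)
    open PowerSeries ring using (seriesRing; liftMorphism; ι-cong)
    equal? : WeaklyDecidable _
    equal? a b with embed-equal? a b
    ... | just e = just (ι-cong e)
    ... | nothing = nothing

  -- Proving an identity L ≈ R from known relations aᵢ ≈ bᵢ: the solver writes L - R as
  -- ∑ cᵢ (aᵢ - bᵢ), and each summand vanishes.
  module Relations {c ℓ} (R : CommutativeRing c ℓ) where

    open CommutativeRing R
    open import Algebra.Properties.Group +-group using (x∙y⁻¹≈ε⇒x≈y; x≈y⇒x∙y⁻¹≈ε)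

    infixl 6 _⊕_
    infixr 7 _⊙_

    Vanishes : Carrier → Set ℓ
    Vanishes z = z ≈ 0#

    relation : ∀ {a b} → a ≈ b → Vanishes (a + - b)
    relation = x≈y⇒x∙y⁻¹≈ε

    _⊙_ : ∀ a {z} → Vanishes z → Vanishes (a * z)
    a ⊙ e = trans (*-congˡ e) (zeroʳ a)

    _⊕_ : ∀ {z w} → Vanishes z → Vanishes w → Vanishes (z + w)
    e ⊕ f = trans (+-cong e f) (+-identityˡ 0#)

    by-relations : ∀ {L R z} → L + - R ≈ z → Vanishes z → L ≈ R
    by-relations e z≈0 = x∙y⁻¹≈ε⇒x≈y _ _ (trans e z≈0)

module Bivariate where

  open import Data.Nat as ℕ using (ℕ; zero; suc)
  open import Data.Integer as ℤ using (ℤ; +_)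
  open import Data.Integer.Properties using (+-*-commutativeRing)
  open import Relation.Binary.PropositionalEquality as ≡ using (_≡_; refl)
  open import Algebra.Bundles using (CommutativeRing)
  open import Defs
  open FormalPowerSeries using (module PowerSeries)
  open IntegerAlgebra using (ℤ-Algebra; ℤ-algebra; seriesAlgebra)

  -- ℤ[[x]] and ℤ[[x]][[q]]: in the latter, the outer index is the exponent of q.
  module S = PowerSeries +-*-commutativeRing
  module B = PowerSeries S.seriesRing
  module SR = CommutativeRing S.seriesRing
  module BR = CommutativeRing B.seriesRing

  module SSolver = ℤ-Algebra (seriesAlgebra ℤ-algebra)
  module BSolver = ℤ-Algebra (seriesAlgebra (seriesAlgebra ℤ-algebra))

  sumℤ≡∑ : ∀ n g → sumℤ n g ≡ S.∑ n g
  sumℤ≡∑ zero g = refl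
  sumℤ≡∑ (suc n) g = ≡.cong (ℤ._+ g n) (sumℤ≡∑ n g)

  ⊛≋✶ : ∀ a b → a ⊛ b S.≋ a S.✶ b
  ⊛≋✶ a b n = ≡.trans (sumℤ≡∑ (suc n) _) (≡.sym (S.✶-unfold a b n))

  one≋𝟙 : one S.≋ S.𝟙
  one≋𝟙 zero = refl
  one≋𝟙 (suc n) = refl

  ^ˢ≋^ : ∀ a m → a ^ˢ m S.≋ a S.^ m
  ^ˢ≋^ a zero = one≋𝟙
  ^ˢ≋^ a (suc m) n = ≡.trans (⊛≋✶ a (a ^ˢ m) n) (S.✶-congˡ a (^ˢ≋^ a m) n)

  xpow≋X^ : ∀ e → xpow e S.≋ S.X S.^ e
  xpow≋X^ e n = ≡.trans (xpow≡shiftBy e n) (≡.sym (S.X^≋shiftBy e n))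
    where
    xpow≡shiftBy : ∀ e n → xpow e n ≡ S.shiftBy e S.𝟙 n
    xpow≡shiftBy zero zero = refl
    xpow≡shiftBy zero (suc n) = refl
    xpow≡shiftBy (suc e) zero = refl
    xpow≡shiftBy (suc e) (suc n) = xpow≡shiftBy e n

  scale≋ι✶ : ∀ c a → scale c a S.≋ S.ι c S.✶ a
  scale≋ι✶ c a n = ≡.sym (S.ι✶ c a n)

  R-rec : ∀ m → R (suc (suc m)) S.≋ R (suc m) S.⊞ S.⊟ (S.X S.✶ R m)
  R-rec m n = ≡.cong (λ z → R (suc m) n ℤ.+ ℤ.- z) (shift≋X✶ (R m) n)
    where
    shift≋X✶ : ∀ a → shift a S.≋ S.X S.✶ a
    shift≋X✶ a zero = ≡.sym (S.X✶ a zero)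
    shift≋X✶ a (suc n) = ≡.sym (S.X✶ a (suc n))

  x̂ : B.Series
  x̂ = B.ι S.X

  R̂ : ℕ → B.Series
  R̂ m = B.ι (R m)

  R̂-0 : R̂ 0 B.≋ B.𝟙
  R̂-0 = B.ι-cong one≋𝟙

  R̂-1 : R̂ 1 B.≋ B.𝟙
  R̂-1 = B.ι-cong one≋𝟙

  R̂-rec : ∀ m → R̂ (suc (suc m)) B.≋ R̂ (suc m) B.⊞ B.⊟ (x̂ B.✶ R̂ m)
  R̂-rec m = BR.trans (B.ι-cong (R-rec m)) (BR.trans (B.ι-+ (R (suc m)) _)
    (BR.+-congˡ {B.ι (R (suc m))} (BR.trans (B.ι-neg (S.X S.✶ R m)) (BR.-‿cong (B.ι-* S.X (R m))))))

  -- x c q^m a, the shape of every term of the recursions below.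
  lagged : S.Series → ℕ → B.Series → B.Series
  lagged c m a = x̂ B.✶ (B.ι c B.✶ (B.X B.^ m B.✶ a))

  lagged-coeff : ∀ c m a r → lagged c m a r S.≋ S.X S.✶ (c S.✶ B.shiftBy m a r)
  lagged-coeff c m a r = SR.trans (B.ι✶ S.X _ r) (S.✶-congˡ S.X (SR.trans (B.ι✶ c _ r) (S.✶-congˡ c (B.powX✶ m a r))))

  lagged-causal : ∀ c m {r a b} → B.AgreeBelow r a b → lagged c (suc m) a r S.≋ lagged c (suc m) b r
  lagged-causal c m {r} {a} {b} e = SR.trans (lagged-coeff c (suc m) a r)
    (SR.trans (S.✶-congˡ S.X (S.✶-congˡ c (B.shiftBy-causal m e))) (SR.sym (lagged-coeff c (suc m) b r)))

  lagged-cong : ∀ c m {a b} → a B.≋ b → lagged c m a B.≋ lagged c m b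
  lagged-cong c m e = B.✶-congˡ x̂ (B.✶-congˡ (B.ι c) (B.✶-congˡ (B.X B.^ m) e))

  lagged-0 : ∀ c m a → lagged c (suc m) a 0 S.≋ S.𝟘
  lagged-0 c m a = SR.trans (lagged-coeff c (suc m) a 0) (SR.trans (S.✶-congˡ S.X (SR.zeroʳ c)) (SR.zeroʳ S.X))

module ContinuedFractions where

  open import Data.Nat as ℕ using (ℕ; zero; suc; _∸_; _≤_; _<_; z≤n; s≤s)
  import Data.Nat.Properties as ℕₚ
  open import Data.Nat.Combinatorics using (_C_; nCn≡1; k>n⇒nCk≡0)
  open import Relation.Binary.PropositionalEquality as ≡ using (_≡_)
  open import Data.Integer using (+_)
  open Bivariate using (module B; module BR; module BSolver)
  open IntegerAlgebra using (module Relations)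

  open B using (Series; _≋_; _✶_; _⊞_; ⊟_; 𝟘; 𝟙; _^_)
  open BR using (refl; sym; trans; +-congˡ; *-congˡ)
  open BSolver using (solve; _:=_; _:+_; _:*_; _:-_; :-_; con)
  open Relations B.seriesRing
  open import Relation.Binary.Reasoning.Setoid BR.setoid
  open import Algebra.Properties.Group BR.+-group using (ε⁻¹≈ε)

  ⊟✶𝟘 : ∀ a c → a ⊞ ⊟ (c ✶ 𝟘) ≋ a
  ⊟✶𝟘 a c = trans (+-congˡ {a} (trans (BR.-‿cong (BR.zeroʳ c)) ε⁻¹≈ε)) (BR.+-identityʳ a)

  module Continuants (x : Series) (U : ℕ → Series)
    (U-0 : U 0 ≋ 𝟙) (U-1 : U 1 ≋ 𝟙) (U-rec : ∀ m → U (suc (suc m)) ≋ U (suc m) ⊞ ⊟ (x ✶ U m)) where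

    U₋ : ℕ → Series
    U₋ zero = 𝟘
    U₋ (suc m) = U m

    U-rec₋ : ∀ m → U (suc m) ≋ U m ⊞ ⊟ (x ✶ U₋ m)
    U-rec₋ zero = trans U-1 (trans (sym U-0) (sym (⊟✶𝟘 (U 0) x)))
    U-rec₋ (suc m) = U-rec m

    cassini : ∀ m → U m ✶ U m ⊞ ⊟ (U (suc m) ✶ U₋ m) ≋ x ^ m
    cassini zero = begin
      U 0 ✶ U 0 ⊞ ⊟ (U 1 ✶ 𝟘) ≈⟨ BR.+-cong (BR.*-cong U-0 U-0) (BR.-‿cong {U 1 ✶ 𝟘} (BR.zeroʳ (U 1))) ⟩
      𝟙 ✶ 𝟙 ⊞ ⊟ 𝟘             ≈⟨ +-congˡ {𝟙 ✶ 𝟙} ε⁻¹≈ε ⟩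
      𝟙 ✶ 𝟙 ⊞ 𝟘               ≈⟨ trans (BR.+-identityʳ _) (BR.*-identityˡ 𝟙) ⟩
      𝟙                       ∎
    cassini (suc m) = by-relations
      (solve 6 (λ u₋ u u′ u″ x p →
         u′ :* u′ :- u″ :* u :- x :* p :=
         (:- u) :* (u″ :- (u′ :- x :* u)) :+ u′ :* (u′ :- (u :- x :* u₋)) :+ x :* (u :* u :- u′ :* u₋ :- p))
         (λ _ _ → ≡.refl) (U₋ m) (U m) (U (suc m)) (U (suc (suc m))) x (x ^ m))
      (⊟ U m ⊙ relation (U-rec m) ⊕ U (suc m) ⊙ relation (U-rec₋ m) ⊕ x ⊙ relation (cassini m))

    -- G_d = 1 + x q^{C(d,j)} G_{d+1} G_d is the continued fraction G_d = 1/(1 - x q^{C(d,j)} G_{d+1});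
    -- its first j levels have trivial exponent, and its convergents are quotients of the U_m.
    module ContinuedFraction (q : Series) (j : ℕ) (G : ℕ → Series)
      (G-rec : ∀ d → G d ≋ 𝟙 ⊞ x ✶ (q ^ (d C j) ✶ (G (suc d) ✶ G d))) where

      k : ℕ
      k = suc j

      W : Series
      W = x ✶ (q ✶ G k)

      G-top : G j ≋ 𝟙 ⊞ W ✶ G j
      G-top = trans (G-rec j) (≡.subst (λ e → 𝟙 ⊞ x ✶ (q ^ e ✶ (G k ✶ G j)) ≋ 𝟙 ⊞ W ✶ G j) (≡.sym (nCn≡1 j))
        (solve 4 (λ g g′ x q → con (+ 1) :+ x :* ((q :* con (+ 1)) :* (g′ :* g)) := con (+ 1) :+ (x :* (q :* g′)) :* g)
          (λ _ _ → ≡.refl) (G j) (G k) x q))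

      G-below : ∀ d → d < j → G d ≋ 𝟙 ⊞ x ✶ (G (suc d) ✶ G d)
      G-below d d<j = trans (G-rec d) (≡.subst (λ e → 𝟙 ⊞ x ✶ (q ^ e ✶ (G (suc d) ✶ G d)) ≋ 𝟙 ⊞ x ✶ (G (suc d) ✶ G d))
        (≡.sym (k>n⇒nCk≡0 d<j)) (+-congˡ {𝟙} (*-congˡ {x} (BR.*-identityˡ (G (suc d) ✶ G d)))))

      convergent : ∀ m → m ≤ j → G (j ∸ m) ✶ (U (suc m) ⊞ ⊟ (W ✶ U m)) ≋ U m ⊞ ⊟ (W ✶ U₋ m)
      convergent zero _ = begin
        G j ✶ (U 1 ⊞ ⊟ (W ✶ U 0)) ≈⟨ *-congˡ {G j} (BR.+-cong U-1 (BR.-‿cong (*-congˡ {W} U-0))) ⟩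
        G j ✶ (𝟙 ⊞ ⊟ (W ✶ 𝟙))     ≈⟨ by-relations
                                      (solve 2 (λ g w → g :* (con (+ 1) :- w :* con (+ 1)) :- con (+ 1) := g :- (con (+ 1) :+ w :* g))
                                        (λ _ _ → ≡.refl) (G j) W)
                                      (relation G-top) ⟩
        𝟙                         ≈⟨ sym (trans (⊟✶𝟘 (U 0) W) U-0) ⟩
        U 0 ⊞ ⊟ (W ✶ 𝟘)           ∎
      convergent (suc m) m<j = by-relations
        (solve 9 (λ g g′ u₋ u u′ u″ x w q →
           g :* (u″ :- w :* u′) :- (u′ :- w :* u) :=
           g :* (u″ :- (u′ :- x :* u)) :+ (:- (g :* w)) :* (u′ :- (u :- x :* u₋))
           :+ (x :* g) :* (g′ :* (u′ :- w :* u) :- (u :- w :* u₋))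
           :+ (u′ :- w :* u) :* (g :- (con (+ 1) :+ x :* (g′ :* g))))
           (λ _ _ → ≡.refl) (G d) (G (suc d)) (U₋ m) (U m) (U (suc m)) (U (suc (suc m))) x W q)
        (G d ⊙ relation (U-rec m) ⊕ (⊟ (G d ✶ W)) ⊙ relation (U-rec₋ m)
          ⊕ (x ✶ G d) ⊙ relation previous
          ⊕ (U (suc m) ⊞ ⊟ (W ✶ U m)) ⊙ relation (G-below d d<j))
        where
        d = j ∸ suc m
        suc-d : suc d ≡ j ∸ m
        suc-d = ≡.sym (ℕₚ.+-∸-assoc 1 m<j)
        d<j : d < j
        d<j = ℕₚ.∸-monoʳ-< {j} (s≤s z≤n) m<j
        previous : G (suc d) ✶ (U (suc m) ⊞ ⊟ (W ✶ U m)) ≋ U m ⊞ ⊟ (W ✶ U₋ m)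
        previous = ≡.subst (λ e → G e ✶ (U (suc m) ⊞ ⊟ (W ✶ U m)) ≋ U m ⊞ ⊟ (W ✶ U₋ m)) (≡.sym suc-d) (convergent m (ℕₚ.<⇒≤ m<j))

      E : Series
      E = G 0 ✶ U k ⊞ ⊟ U j

      G₀-convergent : G 0 ✶ (U k ⊞ ⊟ (W ✶ U j)) ≋ U j ⊞ ⊟ (W ✶ U₋ j)
      G₀-convergent = ≡.subst (λ e → G e ✶ (U k ⊞ ⊟ (W ✶ U j)) ≋ U j ⊞ ⊟ (W ✶ U₋ j)) (ℕₚ.n∸n≡0 j) (convergent j ℕₚ.≤-refl)

      E-factor : E ≋ W ✶ (G 0 ✶ U j ⊞ ⊟ U₋ j)
      E-factor = by-relations
        (solve 5 (λ g u₋ u u′ w →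
           (g :* u′ :- u) :- w :* (g :* u :- u₋) := g :* (u′ :- w :* u) :- (u :- w :* u₋))
           (λ _ _ → ≡.refl) (G 0) (U₋ j) (U j) (U k) W)
        (relation G₀-convergent)

      E-identity : E ✶ (U k ⊞ ⊟ (W ✶ U j)) ≋ x ^ j ✶ W
      E-identity = by-relations
        (solve 6 (λ g u₋ u u′ w p →
           (g :* u′ :- u) :* (u′ :- w :* u) :- p :* w :=
           u′ :* (g :* (u′ :- w :* u) :- (u :- w :* u₋)) :+ w :* (u :* u :- u′ :* u₋ :- p))
           (λ _ _ → ≡.refl) (G 0) (U₋ j) (U j) (U k) W (x ^ j))
        (U k ⊙ relation G₀-convergent ⊕ W ⊙ relation (cassini j))

      -- The level k recurrence, with G_{k+1} - 1 split off as the error term.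
      E-identity′ : E ✶ (U k ✶ (𝟙 ⊞ ⊟ (x ✶ q ^ (k C j))) ⊞ ⊟ (x ✶ (q ✶ U j)))
                    ≋ x ^ j ✶ (x ✶ q) ⊞ E ✶ (U k ✶ (x ✶ (q ^ (k C j) ✶ (G (suc k) ⊞ ⊟ 𝟙))))
      E-identity′ = by-relations
        (solve 9 (λ e u u′ p x q g′ g″ qK →
           e :* (u′ :* (con (+ 1) :- x :* qK) :- x :* (q :* u)) :- (p :* (x :* q) :+ e :* (u′ :* (x :* (qK :* (g″ :- con (+ 1)))))) :=
           (con (+ 1) :- x :* (qK :* g″)) :* (e :* (u′ :- (x :* (q :* g′)) :* u) :- p :* (x :* (q :* g′)))
           :+ (p :* (x :* q) :+ e :* (x :* q) :* u) :* (g′ :- (con (+ 1) :+ x :* (qK :* (g″ :* g′)))))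
           (λ _ _ → ≡.refl) E (U j) (U k) (x ^ j) x q (G k) (G (suc k)) (q ^ (k C j)))
        ((𝟙 ⊞ ⊟ (x ✶ (q ^ (k C j) ✶ G (suc k)))) ⊙ relation E-identity
          ⊕ (x ^ j ✶ (x ✶ q) ⊞ E ✶ (x ✶ q) ✶ U j) ⊙ relation (G-rec k))

module Numerators where

  open import Data.Nat as ℕ using (ℕ; zero; suc; _+_; _*_; _∸_; _≤_; _<_)
  import Data.Nat.Properties as ℕₚ
  open import Data.Nat.Combinatorics using (_C_; nCn≡1; nCk+nC[k+1]≡[n+1]C[k+1])
  open import Data.Nat.DivMod using (_/_; m/n*n≤m; m≡m%n+[m/n]*n; m%n<n)
  open import Data.Integer using (+_)
  open import Relation.Binary.PropositionalEquality as ≡ using (_≡_)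
  open import Defs using (R; numer; term; sumS; xpow; _^ˢ_)
  open Sums using (module FiniteSum)
  open IntegerAlgebra using (module Relations)
  open Bivariate

  exponent-arithmetic : ∀ j i p → suc j * i ≤ p → (p + suc j) ∸ j * i ≡ suc j + (p ∸ suc j * i) + i
  exponent-arithmetic j i p ki≤p = begin
    (p + suc j) ∸ j * i                ≡⟨ ≡.cong (λ n → (n + suc j) ∸ j * i) (≡.sym (ℕₚ.m+[n∸m]≡n ki≤p)) ⟩
    ((i + j * i) + m + suc j) ∸ j * i
      ≡⟨ ≡.cong (_∸ j * i) (solve 4 (λ i ji m k → ((i :+ ji) :+ m) :+ k := ji :+ ((k :+ m) :+ i)) ≡.refl i (j * i) m (suc j)) ⟩
    (j * i + (suc j + m + i)) ∸ j * i   ≡⟨ ℕₚ.m+n∸m≡n (j * i) (suc j + m + i) ⟩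
    suc j + m + i                      ∎
    where
    open ≡.≡-Reasoning
    open import Data.Nat.Solver using (module +-*-Solver)
    open +-*-Solver using (solve; _:+_; _:=_)
    m = p ∸ suc j * i

  module BinomialTerms (j : ℕ) where

    k : ℕ
    k = suc j

    open S using (Series; _≋_; _✶_; _⊞_; ι; X; 𝟙; _^_)
    open SR using (refl; sym; trans)
    open SSolver using (solve; _:=_; _:+_; _:*_; con)
    open import Relation.Binary.Reasoning.Setoid SR.setoid
    open import Algebra.Properties.Semiring.Exp SR.semiring using (^-congʳ; ^-homo-*)

    -- C(m+i, i) x^{k+m+i} R_{k-1}^m R_k^{ki}: the contribution of the words with m letters
    -- x R_{k-1} q and i letters x R_k^k q^k.
    binomialTerm : ℕ → ℕ → Series
    binomialTerm i m = ι (+ ((m + i) C i)) ✶ (X ^ (k + m + i) ✶ (R j ^ m ✶ R k ^ (k * i)))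

    X^-suc : ∀ {a b} → a ≡ suc b → X ^ a ≋ X ✶ X ^ b
    X^-suc ≡.refl = refl

    R^k*suc : ∀ i → R k ^ (k * suc i) ≋ R k ^ k ✶ R k ^ (k * i)
    R^k*suc i = trans (^-congʳ (R k) (ℕₚ.*-suc k i)) (^-homo-* (R k) k (k * i))

    binomialTerm-0-0 : binomialTerm 0 0 ≋ X ^ k
    binomialTerm-0-0 = begin
      ι (+ 1) ✶ (X ^ (k + 0 + 0) ✶ (𝟙 ✶ R k ^ (k * 0))) ≡⟨ ≡.cong₂ (λ a b → ι (+ 1) ✶ (X ^ a ✶ (𝟙 ✶ R k ^ b)))
                                                            (≡.trans (ℕₚ.+-identityʳ _) (ℕₚ.+-identityʳ k)) (ℕₚ.*-zeroʳ k) ⟩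
      ι (+ 1) ✶ (X ^ k ✶ (𝟙 ✶ 𝟙))                       ≈⟨ solve 1 (λ xk → con (+ 1) :* (xk :* (con (+ 1) :* con (+ 1))) := xk)
                                                            (λ _ → ≡.refl) (X ^ k) ⟩
      X ^ k                                             ∎

    binomialTerm-0-suc : ∀ m → binomialTerm 0 (suc m) ≋ X ✶ (R j ✶ binomialTerm 0 m)
    binomialTerm-0-suc m = trans (S.✶-congˡ _ (S.✶-congʳ _ (X^-suc (≡.cong (_+ 0) (ℕₚ.+-suc k m)))))
      (solve 6 (λ c x xᵉ u u^m v → c :* ((x :* xᵉ) :* ((u :* u^m) :* v)) := x :* (u :* (c :* (xᵉ :* (u^m :* v)))))
        (λ _ → ≡.refl) (ι (+ 1)) X (X ^ (k + m + 0)) (R j) (R j ^ m) (R k ^ (k * 0)))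

    binomialTerm-suc-0 : ∀ i → binomialTerm (suc i) 0 ≋ X ✶ (R k ^ k ✶ binomialTerm i 0)
    binomialTerm-suc-0 i = begin
      ι (+ (suc i C suc i)) ✶ (X ^ (k + 0 + suc i) ✶ (𝟙 ✶ R k ^ (k * suc i)))
        ≈⟨ S.✶-cong (S.ι-cong (≡.cong +_ (nCn≡1 (suc i)))) (S.✶-cong (X^-suc (ℕₚ.+-suc (k + 0) i)) (S.✶-congˡ 𝟙 (R^k*suc i))) ⟩
      ι (+ 1) ✶ ((X ✶ X ^ (k + 0 + i)) ✶ (𝟙 ✶ (R k ^ k ✶ R k ^ (k * i))))
        ≈⟨ solve 5 (λ x xᵉ o w v → con (+ 1) :* ((x :* xᵉ) :* (o :* (w :* v))) := x :* (w :* (con (+ 1) :* (xᵉ :* (o :* v)))))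
             (λ _ → ≡.refl) X (X ^ (k + 0 + i)) 𝟙 (R k ^ k) (R k ^ (k * i)) ⟩
      X ✶ (R k ^ k ✶ (ι (+ 1) ✶ (X ^ (k + 0 + i) ✶ (𝟙 ✶ R k ^ (k * i)))))
        ≈⟨ S.✶-congˡ X (S.✶-congˡ (R k ^ k) (S.✶-congʳ _ (S.ι-cong (≡.cong +_ (≡.sym (nCn≡1 i)))))) ⟩
      X ✶ (R k ^ k ✶ binomialTerm i 0) ∎

    binomialTerm-suc-suc : ∀ i m → binomialTerm (suc i) (suc m) ≋
      X ✶ (R k ^ k ✶ binomialTerm i (suc m)) ⊞ X ✶ (R j ✶ binomialTerm (suc i) m)
    binomialTerm-suc-suc i m = begin
      ι (+ ((suc m + suc i) C suc i)) ✶ (X ^ (k + suc m + suc i) ✶ (R j ^ suc m ✶ R k ^ (k * suc i)))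
        ≈⟨ S.✶-cong (trans (S.ι-cong (≡.cong +_ pascal)) (S.ι-+ (+ c₁) (+ c₂)))
             (S.✶-cong (X^-suc (ℕₚ.+-suc (k + suc m) i)) (S.✶-congˡ (R j ^ suc m) (R^k*suc i))) ⟩
      (ι (+ c₁) ⊞ ι (+ c₂)) ✶ ((X ✶ X ^ (k + suc m + i)) ✶ (R j ^ suc m ✶ (R k ^ k ✶ R k ^ (k * i))))
        ≈⟨ solve 8 (λ c₁ c₂ x xᵉ u u^m w v →
             (c₁ :+ c₂) :* ((x :* xᵉ) :* ((u :* u^m) :* (w :* v))) :=
             x :* (w :* (c₁ :* (xᵉ :* ((u :* u^m) :* v)))) :+ x :* (u :* (c₂ :* (xᵉ :* (u^m :* (w :* v))))))
             (λ _ → ≡.refl) (ι (+ c₁)) (ι (+ c₂)) X (X ^ (k + suc m + i)) (R j) (R j ^ m) (R k ^ k) (R k ^ (k * i)) ⟩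
      X ✶ (R k ^ k ✶ binomialTerm i (suc m)) ⊞ X ✶ (R j ✶ (ι (+ c₂) ✶ (X ^ (k + suc m + i) ✶ (R j ^ m ✶ (R k ^ k ✶ R k ^ (k * i))))))
        ≈⟨ S.⊞-congˡ (X ✶ (R k ^ k ✶ binomialTerm i (suc m))) (S.✶-congˡ X (S.✶-congˡ (R j) (S.✶-congˡ (ι (+ c₂))
             (S.✶-cong (^-congʳ X exponent) (S.✶-congˡ (R j ^ m) (sym (R^k*suc i))))))) ⟩
      X ✶ (R k ^ k ✶ binomialTerm i (suc m)) ⊞ X ✶ (R j ✶ binomialTerm (suc i) m) ∎
      where
      c₁ = (suc m + i) C i
      c₂ = (m + suc i) C suc i
      pascal : (suc m + suc i) C suc i ≡ c₁ + c₂
      pascal = ≡.trans (≡.cong (_C suc i) (ℕₚ.+-suc (suc m) i))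
        (≡.trans (≡.sym (nCk+nC[k+1]≡[n+1]C[k+1] (suc m + i) i)) (≡.cong (λ n → c₁ + n C suc i) (≡.sym (ℕₚ.+-suc m i))))
      exponent : k + suc m + i ≡ k + m + suc i
      exponent = ≡.trans (≡.cong (_+ i) (ℕₚ.+-suc k m)) (≡.sym (ℕₚ.+-suc (k + m) i))

  module NumeratorSeries (j : ℕ) where

    open BinomialTerms j public using (k)
    open BinomialTerms j using (binomialTerm; binomialTerm-0-0; binomialTerm-0-suc; binomialTerm-suc-0; binomialTerm-suc-suc)
    open S using (Series; _≋_; _✶_; _⊞_; ι; X; _^_)
    open SR using (refl; sym; trans)
    open BR using () renaming (refl to ≋-refl; sym to ≋-sym; trans to ≋-trans)
    open Relations B.seriesRing
    open BSolver using (solve; _:=_; _:+_; _:*_; _:-_; con)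
    open import Relation.Binary.Reasoning.Setoid SR.setoid
    open import Algebra.Properties.Semiring.Exp SR.semiring using (^-congʳ)
    open import Algebra.Properties.Semiring.Exp BR.semiring using () renaming (^-congʳ to ^ᴮ-congʳ; ^-homo-* to ^ᴮ-homo-*)

    recursion : B.Series → B.Series → B.Series
    recursion s P = s B.⊞ lagged (R j) 1 P B.⊞ lagged (R k ^ k) k P

    recursion-causal : ∀ s → B.Causal (recursion s)
    recursion-causal s a b r e = S.⊞-cong (S.⊞-congˡ (s r) (lagged-causal (R j) 0 e)) (lagged-causal (R k ^ k) j e)

    T : ℕ → B.Series
    T = binomialTerm

    private
      dropTail : ∀ a c → a ⊞ X ✶ (c ✶ S.𝟘) ≋ a
      dropTail a c = trans (S.⊞-congˡ a (trans (S.✶-congˡ X (SR.zeroʳ c)) (SR.zeroʳ X))) (SR.+-identityʳ a)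

    T-0 : T 0 B.≋ B.ι (X ^ k) B.⊞ lagged (R j) 1 (T 0)
    T-0 r = trans (pascal r) (sym (S.⊞-congˡ (B.ι (X ^ k) r) (lagged-coeff (R j) 1 (T 0) r)))
      where
      pascal : ∀ r → T 0 r ≋ B.ι (X ^ k) r ⊞ X ✶ (R j ✶ B.shift (T 0) r)
      pascal zero = trans binomialTerm-0-0 (sym (dropTail (X ^ k) (R j)))
      pascal (suc m) = trans (binomialTerm-0-suc m) (sym (SR.+-identityˡ _))

    T-suc : ∀ i → T (suc i) B.≋ lagged (R k ^ k) 0 (T i) B.⊞ lagged (R j) 1 (T (suc i))
    T-suc i r = trans (pascal r) (sym (S.⊞-cong (lagged-coeff (R k ^ k) 0 (T i) r) (lagged-coeff (R j) 1 (T (suc i)) r)))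
      where
      pascal : ∀ r → T (suc i) r ≋ X ✶ (R k ^ k ✶ T i r) ⊞ X ✶ (R j ✶ B.shift (T (suc i)) r)
      pascal zero = trans (binomialTerm-suc-0 i) (sym (dropTail _ (R j)))
      pascal (suc m) = binomialTerm-suc-suc i m

    -- q^{ki} T_i collects the words with i letters x R_k^k q^k.
    L : ℕ → B.Series
    L i = B.X B.^ (k * i) B.✶ T i

    L-low : ∀ i {p} → p < k * i → L i p ≋ S.𝟘
    L-low i {p} p<ki = trans (B.powX✶ (k * i) (T i) p) (B.X^∣-shiftBy (k * i) (T i) p p<ki)

    L-high : ∀ i m → L i (k * i + m) ≋ binomialTerm i m
    L-high i m = trans (B.powX✶ (k * i) (T i) (k * i + m)) (B.shiftBy-high (k * i) (T i) m)


    L-0 : L 0 B.≋ B.ι (X ^ k) B.⊞ lagged (R j) 1 (L 0)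
    L-0 = ≋-trans L0≋T0 (≋-trans T-0 (B.⊞-congˡ (B.ι (X ^ k)) (lagged-cong (R j) 1 (≋-sym L0≋T0))))
      where
      L0≋T0 : L 0 B.≋ T 0
      L0≋T0 = ≋-trans (B.✶-congʳ (T 0) (^ᴮ-congʳ B.X (ℕₚ.*-zeroʳ k))) (B.✶-identityˡ (T 0))

    L-suc : ∀ i → L (suc i) B.≋ lagged (R k ^ k) k (L i) B.⊞ lagged (R j) 1 (L (suc i))
    L-suc i = by-relations
      (solve 9 (λ x c₁ c₂ q qᵏ qᵏⁱ P t t′ →
         P :* t′ :- (x :* (c₂ :* (qᵏ :* (qᵏⁱ :* t))) :+ x :* (c₁ :* ((q :* con (+ 1)) :* (P :* t′)))) :=
         (t′ :- x :* (c₁ :* ((q :* con (+ 1)) :* t′))) :* (P :- qᵏ :* qᵏⁱ)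
         :+ (qᵏ :* qᵏⁱ) :* (t′ :- (x :* (c₂ :* (con (+ 1) :* t)) :+ x :* (c₁ :* ((q :* con (+ 1)) :* t′)))))
        (λ _ _ → ≡.refl) x̂ (B.ι (R j)) (B.ι (R k ^ k)) B.X (B.X B.^ k) (B.X B.^ (k * i)) (B.X B.^ (k * suc i)) (T i) (T (suc i)))
      ((T (suc i) B.⊞ B.⊟ lagged (R j) 1 (T (suc i))) ⊙ relation X^k*suc ⊕ (B.X B.^ k B.✶ B.X B.^ (k * i)) ⊙ relation (T-suc i))
      where
      X^k*suc : B.X B.^ (k * suc i) B.≋ B.X B.^ k B.✶ B.X B.^ (k * i)
      X^k*suc = ≋-trans (^ᴮ-congʳ B.X (ℕₚ.*-suc k i)) (^ᴮ-homo-* B.X k (k * i))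

    open FiniteSum BR.commutativeSemiring using () renaming (∑ to ∑ᴮ)

    partial : ℕ → B.Series
    partial J = ∑ᴮ J L

    partial-rec : ∀ J → partial (suc J) B.≋ B.ι (X ^ k) B.⊞ lagged (R j) 1 (partial (suc J)) B.⊞ lagged (R k ^ k) k (partial J)
    partial-rec zero = by-relations
      (solve 8 (λ s x c₁ c₂ q qᵏ l z →
         (z :+ l) :- (s :+ x :* (c₁ :* ((q :* con (+ 1)) :* (z :+ l))) :+ x :* (c₂ :* (qᵏ :* z))) :=
         (l :- (s :+ x :* (c₁ :* ((q :* con (+ 1)) :* l))))
         :+ (con (+ 1) :- x :* (c₁ :* (q :* con (+ 1))) :- x :* (c₂ :* qᵏ)) :* z)
        (λ _ _ → ≡.refl) (B.ι (X ^ k)) x̂ (B.ι (R j)) (B.ι (R k ^ k)) B.X (B.X B.^ k) (L 0) B.𝟘)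
      (relation L-0 ⊕ (B.𝟙 B.⊞ B.⊟ (x̂ B.✶ (B.ι (R j) B.✶ B.X B.^ 1)) B.⊞ B.⊟ (x̂ B.✶ (B.ι (R k ^ k) B.✶ B.X B.^ k))) ⊙ ≋-refl {B.𝟘})
    partial-rec (suc J) = by-relations
      (solve 9 (λ s x c₁ c₂ q qᵏ p l l′ →
         (p :+ l :+ l′) :- (s :+ x :* (c₁ :* ((q :* con (+ 1)) :* (p :+ l :+ l′))) :+ x :* (c₂ :* (qᵏ :* (p :+ l)))) :=
         ((p :+ l) :- (s :+ x :* (c₁ :* ((q :* con (+ 1)) :* (p :+ l))) :+ x :* (c₂ :* (qᵏ :* p))))
         :+ (l′ :- (x :* (c₂ :* (qᵏ :* l)) :+ x :* (c₁ :* ((q :* con (+ 1)) :* l′)))))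
        (λ _ _ → ≡.refl) (B.ι (X ^ k)) x̂ (B.ι (R j)) (B.ι (R k ^ k)) B.X (B.X B.^ k) (partial J) (L J) (L (suc J)))
      (relation (partial-rec J) ⊕ relation (L-suc J))

    partial-stable : ∀ J m {p} → p < k * J → partial (J + m) p ≋ partial J p
    partial-stable J zero {p} _ = SR.reflexive (≡.cong (λ n → partial n p) (ℕₚ.+-identityʳ J))
    partial-stable J (suc m) {p} p<kJ = begin
      partial (J + suc m) p          ≡⟨ ≡.cong (λ n → partial n p) (ℕₚ.+-suc J m) ⟩
      partial (J + m) p ⊞ L (J + m) p ≈⟨ S.⊞-cong (partial-stable J m p<kJ) (L-low (J + m) p<k[J+m]) ⟩
      partial J p ⊞ S.𝟘              ≈⟨ SR.+-identityʳ _ ⟩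
      partial J p                    ∎
      where
      p<k[J+m] : p < k * (J + m)
      p<k[J+m] = ℕₚ.<-≤-trans p<kJ (ℕₚ.*-monoʳ-≤ k (ℕₚ.m≤m+n J m))

    numerator : B.Series
    numerator p = partial (suc p) p

    partial≋numerator : ∀ J {p} → p < k * J → partial J p ≋ numerator p
    partial≋numerator J {p} p<kJ = begin
      partial J p             ≈⟨ sym (partial-stable J (suc p) p<kJ) ⟩
      partial (J + suc p) p   ≡⟨ ≡.cong (λ n → partial n p) (ℕₚ.+-comm J (suc p)) ⟩
      partial (suc p + J) p   ≈⟨ partial-stable (suc p) J (ℕₚ.m≤n*m (suc p) k) ⟩
      numerator p             ∎

    numerator-solves : ∀ p → numerator p ≋ recursion (B.ι (X ^ k)) numerator p
    numerator-solves p = begin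
      numerator p                 ≈⟨ sym (partial≋numerator (suc (suc p)) (ℕₚ.≤-trans (ℕₚ.n≤1+n (suc p)) (ℕₚ.m≤n*m (suc (suc p)) k))) ⟩
      partial (suc (suc p)) p     ≈⟨ partial-rec (suc p) p ⟩
      recursion′ (partial (suc (suc p))) (partial (suc p)) p
        ≈⟨ S.⊞-cong (S.⊞-congˡ (B.ι (X ^ k) p) (lagged-causal (R j) 0 (agree (suc (suc p)) (ℕₚ.n≤1+n _))))
                    (lagged-causal (R k ^ k) j (agree (suc p) ℕₚ.≤-refl)) ⟩
      recursion (B.ι (X ^ k)) numerator p ∎
      where
      recursion′ : B.Series → B.Series → B.Series
      recursion′ a b = B.ι (X ^ k) B.⊞ lagged (R j) 1 a B.⊞ lagged (R k ^ k) k b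
      agree : ∀ J → p < J → B.AgreeBelow p (partial J) numerator
      agree J p<J i i<p = partial≋numerator J (ℕₚ.<-≤-trans i<p (ℕₚ.≤-trans (ℕₚ.<⇒≤ p<J) (ℕₚ.m≤n*m J k)))

    term≋binomialTerm : ∀ p i → k * i ≤ p → term (suc p) k i ≋ binomialTerm i (p ∸ k * i)
    term≋binomialTerm p i ki≤p =
      trans (scale≋ι✶ _ _) (S.✶-congˡ (ι (+ ((m + i) C i))) (trans (⊛≋✶ (xpow ((p + k) ∸ j * i)) _)
        (S.✶-cong (trans (xpow≋X^ ((p + k) ∸ j * i)) (^-congʳ X exponent)) (trans (⊛≋✶ (R j ^ˢ m) _) (S.✶-cong (^ˢ≋^ (R j) m) (^ˢ≋^ (R k) (k * i)))))))
      where
      m = p ∸ k * i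
      exponent : (p + k) ∸ j * i ≡ k + m + i
      exponent = exponent-arithmetic j i p ki≤p

    sumS≋partial : ∀ p J → J ≤ suc (p / k) → sumS J (term (suc p) k) ≋ partial J p
    sumS≋partial p zero _ n = ≡.refl
    sumS≋partial p (suc J) J<1+p/k = S.⊞-cong (sumS≋partial p J (ℕₚ.<⇒≤ J<1+p/k)) (begin
      term (suc p) k J             ≈⟨ term≋binomialTerm p J kJ≤p ⟩
      binomialTerm J (p ∸ k * J)   ≈⟨ sym (L-high J (p ∸ k * J)) ⟩
      L J (k * J + (p ∸ k * J))    ≡⟨ ≡.cong (L J) (ℕₚ.m+[n∸m]≡n kJ≤p) ⟩
      L J p                        ∎)
      where
      kJ≤p : k * J ≤ p
      kJ≤p = ℕₚ.≤-trans (ℕₚ.*-monoʳ-≤ k (ℕₚ.≤-pred J<1+p/k)) (≡.subst (_≤ p) (ℕₚ.*-comm (p / k) k) (m/n*n≤m p k))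

    numer≋numerator : ∀ p → numer (suc p) k ≋ numerator p
    numer≋numerator p = trans (sumS≋partial p (suc (p / k)) ℕₚ.≤-refl) (partial≋numerator (suc (p / k)) p<k[1+p/k])
      where
      p<k[1+p/k] : p < k * suc (p / k)
      p<k[1+p/k] = ≡.subst (p <_) (ℕₚ.*-comm (suc (p / k)) k)
        (≡.subst (_< k + p / k * k) (≡.sym (m≡m%n+[m/n]*n p k)) (ℕₚ.+-monoˡ-< (p / k * k) (m%n<n p k)))

    recursion-0 : ∀ s a → recursion s a 0 ≋ s 0
    recursion-0 s a = trans (S.⊞-cong (S.⊞-congˡ (s 0) (lagged-0 (R j) 0 a)) (lagged-0 (R k ^ k) j a))
      (trans (SR.+-identityʳ _) (SR.+-identityʳ _))

module CoefficientComparison where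

  open import Data.Nat as ℕ using (ℕ; zero; suc; _+_; _<_; z≤n; s≤s)
  import Data.Nat.Properties as ℕₚ
  open import Data.Nat.Combinatorics using (_C_; nCk≡nC[n∸k]; nC1≡n)
  open import Data.Integer using (+_)
  open import Relation.Binary.PropositionalEquality as ≡ using (_≡_)
  open import Defs using (R)
  open IntegerAlgebra using (module Relations)
  open Bivariate
  open ContinuedFractions using (module Continuants)
  open Numerators using (module NumeratorSeries)

  sucCn≡suc : ∀ j → suc j C j ≡ suc j
  sucCn≡suc j = ≡.trans (nCk≡nC[n∸k] (ℕₚ.n≤1+n j)) (≡.trans (≡.cong (suc j C_) (ℕₚ.m+n∸n≡m 1 j)) (nC1≡n (suc j)))

  module Coefficients (j : ℕ) (G : ℕ → B.Series)
    (G-rec : ∀ d → G d B.≋ B.𝟙 B.⊞ x̂ B.✶ (B.X B.^ (d C j) B.✶ (G (suc d) B.✶ G d))) where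

    open B using (_≋_; _✶_; _⊞_; ⊟_; 𝟙; _^_; X; X^_∣_)
    open BR using (refl; sym; trans)
    open Relations B.seriesRing
    open BSolver using (solve; _:=_; _:+_; _:*_; _:-_; con)
    open Continuants x̂ R̂ R̂-0 R̂-1 R̂-rec
    open NumeratorSeries j using (recursion; recursion-causal; recursion-0; numerator; numerator-solves)

    open ContinuedFraction X j G G-rec

    M : ℕ
    M = suc k C j

    X∣E : X^ 1 ∣ E
    X∣E = B.X^∣-resp-≋ (sym E-factor) (B.X^∣-✶ (B.X^∣-✶ (B.X^0∣ x̂) (B.X^∣-✶ (B.X^∣-shiftBy 1 𝟙) (B.X^0∣ (G k)))) (B.X^0∣ _))

    X^M∣G₊-1 : X^ M ∣ G (suc k) ⊞ ⊟ 𝟙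
    X^M∣G₊-1 = B.X^∣-resp-≋ (sym G₊-1) (B.X^∣-✶ (B.X^0∣ x̂) (B.X^∣-resp-≋ (sym (B.powX✶ M Z)) (B.X^∣-shiftBy M Z)))
      where
      Z = G (suc (suc k)) ✶ G (suc k)
      G₊-1 : G (suc k) ⊞ ⊟ 𝟙 ≋ x̂ ✶ (X ^ M ✶ Z)
      G₊-1 = by-relations
        (solve 4 (λ g x qᴹ z → (g :- con (+ 1)) :- x :* (qᴹ :* z) := g :- (con (+ 1) :+ x :* (qᴹ :* z)))
          (λ _ _ → ≡.refl) (G (suc k)) x̂ (X ^ M) Z)
        (relation (G-rec (suc k)))

    remainder : B.Series
    remainder = E ✶ (R̂ k ✶ (x̂ ✶ (X ^ k ✶ (G (suc k) ⊞ ⊟ 𝟙))))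

    X^[1+k+M]∣remainder : X^ suc (k + M) ∣ remainder
    X^[1+k+M]∣remainder = B.X^∣-✶ X∣E (B.X^∣-✶ (B.X^0∣ (R̂ k)) (B.X^∣-✶ (B.X^0∣ x̂) (B.X^∣-✶ (B.X^m∣X^m k) X^M∣G₊-1)))

    E-rec : R̂ k ✶ E ≋ X ✶ B.ι (S.X S.^ k) ⊞ lagged (R j) 1 E ⊞ lagged (R k) k E ⊞ remainder
    E-rec = by-relations
      (solve 9 (λ e u u′ x q qᵏ xʲ xᵏ v →
         u′ :* e :- (q :* xᵏ :+ x :* (u :* ((q :* con (+ 1)) :* e)) :+ x :* (u′ :* (qᵏ :* e)) :+ v) :=
         (e :* (u′ :* (con (+ 1) :- x :* qᵏ) :- x :* (q :* u)) :- (xʲ :* (x :* q) :+ v)) :+ (:- q) :* (xᵏ :- x :* xʲ))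
        (λ _ _ → ≡.refl) E (R̂ j) (R̂ k) x̂ X (X ^ k) (x̂ ^ j) (B.ι (S.X S.^ k)) remainder)
      (relation E-identity″ ⊕ (⊟ X) ⊙ relation (B.ι-^ S.X k))
      where
      open BSolver using (:-_)
      E-identity″ : E ✶ (R̂ k ✶ (𝟙 ⊞ ⊟ (x̂ ✶ X ^ k)) ⊞ ⊟ (x̂ ✶ (X ✶ R̂ j))) ≋ x̂ ^ j ✶ (x̂ ✶ X) ⊞ remainder
      E-identity″ = ≡.subst (λ c → E ✶ (R̂ k ✶ (𝟙 ⊞ ⊟ (x̂ ✶ X ^ c)) ⊞ ⊟ (x̂ ✶ (X ✶ R̂ j)))
                                      ≋ x̂ ^ j ✶ (x̂ ✶ X) ⊞ E ✶ (R̂ k ✶ (x̂ ✶ (X ^ c ✶ (G (suc k) ⊞ ⊟ 𝟙)))))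
        (sucCn≡suc j) E-identity′

    open S using () renaming (_≋_ to _≋ₛ_; _✶_ to _✶ₛ_; _⊞_ to _⊞ₛ_; _^_ to _^ₛ_)
    open import Relation.Binary.Reasoning.Setoid SR.setoid
    open SSolver using () renaming (solve to solveₛ; _:=_ to _≐_; _:+_ to _⊹_; _:*_ to _⊗_)

    E-rec-below : ∀ r → r < suc (k + M) →
      R k ✶ₛ E r ≋ₛ (X ✶ B.ι (S.X ^ₛ k)) r ⊞ₛ lagged (R j) 1 E r ⊞ₛ lagged (R k) k E r
    E-rec-below r r<N = begin
      R k ✶ₛ E r ≈⟨ SR.sym (B.ι✶ (R k) E r) ⟩
      (R̂ k ✶ E) r ≈⟨ E-rec r ⟩
      (X ✶ B.ι (S.X ^ₛ k) ⊞ lagged (R j) 1 E ⊞ lagged (R k) k E) r ⊞ₛ remainder r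
        ≈⟨ S.⊞-congˡ ((X ✶ B.ι (S.X ^ₛ k) ⊞ lagged (R j) 1 E ⊞ lagged (R k) k E) r) (X^[1+k+M]∣remainder r r<N) ⟩
      (X ✶ B.ι (S.X ^ₛ k) ⊞ lagged (R j) 1 E ⊞ lagged (R k) k E) r ⊞ₛ S.𝟘
        ≈⟨ SR.+-identityʳ _ ⟩
      (X ✶ B.ι (S.X ^ₛ k)) r ⊞ₛ lagged (R j) 1 E r ⊞ₛ lagged (R k) k E r ∎

    -- Ê = ∑ R_k^r E_r q^r, that is E with q replaced by R_k q.
    Ê : B.Series
    Ê r = R k ^ₛ r ✶ₛ E r

    seed : B.Series
    seed = X ✶ B.ι (S.X ^ₛ k)

    Ê-solves : B.AgreeBelow (suc (k + M)) Ê (recursion seed Ê)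
    Ê-solves zero _ = begin
      S.𝟙 ✶ₛ E 0             ≈⟨ SR.trans (S.✶-congˡ S.𝟙 (X∣E 0 (s≤s z≤n))) (SR.zeroʳ S.𝟙) ⟩
      S.𝟘                    ≈⟨ SR.sym (SR.trans (recursion-0 seed Ê) (B.X✶ (B.ι (S.X ^ₛ k)) 0)) ⟩
      recursion seed Ê 0     ∎
    Ê-solves (suc p) p<N = begin
      (R k ✶ₛ R k ^ₛ p) ✶ₛ E (suc p)
        ≈⟨ solveₛ 3 (λ u u^p e → (u ⊗ u^p) ⊗ e ≐ u^p ⊗ (u ⊗ e)) (λ _ → ≡.refl) (R k) (R k ^ₛ p) (E (suc p)) ⟩
      R k ^ₛ p ✶ₛ (R k ✶ₛ E (suc p))
        ≈⟨ S.✶-congˡ (R k ^ₛ p) (SR.trans (E-rec-below (suc p) p<N)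
             (S.⊞-cong (S.⊞-cong (B.X✶ (B.ι (S.X ^ₛ k)) (suc p)) (lagged-coeff (R j) 1 E (suc p))) (lagged-coeff (R k) k E (suc p)))) ⟩
      R k ^ₛ p ✶ₛ (B.ι (S.X ^ₛ k) p ⊞ₛ S.X ✶ₛ (R j ✶ₛ E p) ⊞ₛ S.X ✶ₛ (R k ✶ₛ B.shiftBy k E (suc p)))
        ≈⟨ solveₛ 7 (λ u^p c x r e u s →
               u^p ⊗ (c ⊹ x ⊗ (r ⊗ e) ⊹ x ⊗ (u ⊗ s)) ≐ u^p ⊗ c ⊹ x ⊗ (r ⊗ (u^p ⊗ e)) ⊹ x ⊗ ((u ⊗ u^p) ⊗ s))
             (λ _ → ≡.refl) (R k ^ₛ p) (B.ι (S.X ^ₛ k) p) S.X (R j) (E p) (R k) (B.shiftBy k E (suc p)) ⟩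
      R k ^ₛ p ✶ₛ B.ι (S.X ^ₛ k) p ⊞ₛ S.X ✶ₛ (R j ✶ₛ Ê p) ⊞ₛ S.X ✶ₛ (R k ^ₛ suc p ✶ₛ B.shiftBy k E (suc p))
        ≈⟨ S.⊞-cong (S.⊞-congʳ _ (seed-scaling p)) (S.✶-congˡ S.X (B.^ᶜ-shiftBy (R k) k E (suc p))) ⟩
      B.ι (S.X ^ₛ k) p ⊞ₛ S.X ✶ₛ (R j ✶ₛ Ê p) ⊞ₛ S.X ✶ₛ (R k ^ₛ k ✶ₛ B.shiftBy k Ê (suc p))
        ≈⟨ SR.sym (S.⊞-cong (S.⊞-cong (B.X✶ (B.ι (S.X ^ₛ k)) (suc p)) (lagged-coeff (R j) 1 Ê (suc p))) (lagged-coeff (R k ^ₛ k) k Ê (suc p))) ⟩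
      recursion seed Ê (suc p) ∎
      where
      seed-scaling : ∀ p → R k ^ₛ p ✶ₛ B.ι (S.X ^ₛ k) p ≋ₛ B.ι (S.X ^ₛ k) p
      seed-scaling zero = S.✶-identityˡ _
      seed-scaling (suc p) = SR.zeroʳ _

    N̂ : B.Series
    N̂ = X ✶ numerator

    N̂-solves : ∀ r → N̂ r ≋ₛ recursion seed N̂ r
    N̂-solves = by-relations
      (solve 7 (λ q n s x c₁ c₂ qᵏ →
         q :* n :- (q :* s :+ x :* (c₁ :* ((q :* con (+ 1)) :* (q :* n))) :+ x :* (c₂ :* (qᵏ :* (q :* n)))) :=
         q :* (n :- (s :+ x :* (c₁ :* ((q :* con (+ 1)) :* n)) :+ x :* (c₂ :* (qᵏ :* n)))))
        (λ _ _ → ≡.refl) X numerator (B.ι (S.X ^ₛ k)) x̂ (B.ι (R j)) (B.ι (R k ^ₛ k)) (X ^ k))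
      (X ⊙ relation numerator-solves)

    Ê≋N̂ : B.AgreeBelow (suc (k + M)) Ê N̂
    Ê≋N̂ = B.causal-unique (recursion-causal seed) (suc (k + M)) Ê-solves (λ r _ → N̂-solves r)

    E-suc : ∀ p → E (suc p) ≋ₛ R k ✶ₛ G 0 (suc p)
    E-suc p = begin
      (G 0 ✶ R̂ k) (suc p) ⊞ₛ S.⊟ S.𝟘 ≈⟨ S.⊞-congˡ ((G 0 ✶ R̂ k) (suc p)) (λ n → ≡.refl) ⟩
      (G 0 ✶ R̂ k) (suc p) ⊞ₛ S.𝟘     ≈⟨ SR.+-identityʳ _ ⟩
      (G 0 ✶ R̂ k) (suc p)           ≈⟨ B.✶-comm (G 0) (R̂ k) (suc p) ⟩
      (R̂ k ✶ G 0) (suc p)           ≈⟨ B.ι✶ (R k) (G 0) (suc p) ⟩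
      R k ✶ₛ G 0 (suc p)            ∎

    numerator-coefficient : ∀ p → p < k + M → R k ^ₛ suc (suc p) ✶ₛ G 0 (suc p) ≋ₛ numerator p
    numerator-coefficient p p<k+M = begin
      (R k ✶ₛ R k ^ₛ suc p) ✶ₛ G 0 (suc p)
        ≈⟨ solveₛ 3 (λ u u^p g → (u ⊗ u^p) ⊗ g ≐ u^p ⊗ (u ⊗ g)) (λ _ → ≡.refl) (R k) (R k ^ₛ suc p) (G 0 (suc p)) ⟩
      R k ^ₛ suc p ✶ₛ (R k ✶ₛ G 0 (suc p)) ≈⟨ S.✶-congˡ (R k ^ₛ suc p) (SR.sym (E-suc p)) ⟩
      Ê (suc p)                          ≈⟨ Ê≋N̂ (suc p) (s≤s p<k+M) ⟩
      N̂ (suc p)                          ≈⟨ B.X✶ numerator (suc p) ⟩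
      numerator p                        ∎

module Lists where

  open import Data.Bool using (Bool; true; false; _∨_; if_then_else_)
  import Data.Bool.Properties as Boolₚ
  open import Data.Bool.ListAction using (any)
  open import Data.Empty using (⊥-elim)
  open import Data.List using (List; []; _∷_; _++_; map; length; filterᵇ; concatMap)
  import Data.List.Properties as Listₚ
  open import Data.List.Membership.Propositional using (_∈_; _∉_; find)
  open import Data.List.Membership.Propositional.Properties using (∈-∃++; ∈-++⁻; ∈-++⁺ˡ; ∈-++⁺ʳ; ∈-concatMap⁻)
  import Data.List.Relation.Unary.All as All
  open All using (All)
  open import Data.List.Relation.Unary.All.Properties using (¬Any⇒All¬; All¬⇒¬Any)
  open import Data.List.Relation.Unary.Any using (here; there)
  open import Data.List.Relation.Unary.Unique.Propositional using (Unique)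
  import Data.List.Relation.Unary.Unique.Propositional.Properties as Uniqueₚ
  open import Data.List.Relation.Unary.AllPairs using ([]; _∷_)
  open import Data.Nat using (ℕ; suc; _+_; _≤_; z≤n; s≤s)
  import Data.Nat.Properties as ℕₚ
  open import Data.List.Membership.DecPropositional ℕₚ._≟_ using (_∈?_)
  open import Data.Product using (_×_; _,_)
  open import Data.Sum using (inj₁; inj₂)
  open import Function using (_∘_)
  open import Relation.Binary.PropositionalEquality as ≡ using (_≡_; _≢_; refl)
  open import Relation.Nullary using (¬_; yes; no)

  private variable
    A B : Set

  count : (A → Bool) → List A → ℕ
  count p [] = 0
  count p (x ∷ xs) = (if p x then 1 else 0) + count p xs

  length-filterᵇ : ∀ (p : A → Bool) xs → length (filterᵇ p xs) ≡ count p xs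
  length-filterᵇ p [] = refl
  length-filterᵇ p (x ∷ xs) with p x
  ... | true = ≡.cong suc (length-filterᵇ p xs)
  ... | false = length-filterᵇ p xs

  count-++ : ∀ (p : A → Bool) xs ys → count p (xs ++ ys) ≡ count p xs + count p ys
  count-++ p [] ys = refl
  count-++ p (x ∷ xs) ys = ≡.trans (≡.cong ((if p x then 1 else 0) +_) (count-++ p xs ys)) (≡.sym (ℕₚ.+-assoc (if p x then 1 else 0) (count p xs) _))

  count-map : ∀ (p : B → Bool) (f : A → B) xs → count p (map f xs) ≡ count (p ∘ f) xs
  count-map p f [] = refl
  count-map p f (x ∷ xs) = ≡.cong ((if p (f x) then 1 else 0) +_) (count-map p f xs)

  count-false : ∀ {p : A → Bool} xs → (∀ x → p x ≡ false) → count p xs ≡ 0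
  count-false [] _ = refl
  count-false (x ∷ xs) e rewrite e x = count-false xs e

  any-++ : ∀ (p : A → Bool) xs ys → any p (xs ++ ys) ≡ any p xs ∨ any p ys
  any-++ p [] ys = refl
  any-++ p (x ∷ xs) ys = ≡.trans (≡.cong (p x ∨_) (any-++ p xs ys)) (≡.sym (Boolₚ.∨-assoc (p x) _ _))

  any-map : ∀ (p : B → Bool) (f : A → B) xs → any p (map f xs) ≡ any (p ∘ f) xs
  any-map p f [] = refl
  any-map p f (x ∷ xs) = ≡.cong (p (f x) ∨_) (any-map p f xs)

  any-cong : ∀ {p q : A → Bool} xs → (∀ x → p x ≡ q x) → any p xs ≡ any q xs
  any-cong [] e = refl
  any-cong (x ∷ xs) e = ≡.cong₂ _∨_ (e x) (any-cong xs e)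

  any-false : ∀ {p : A → Bool} xs → (∀ x → x ∈ xs → p x ≡ false) → any p xs ≡ false
  any-false [] e = refl
  any-false (x ∷ xs) e = ≡.cong₂ _∨_ (e x (here refl)) (any-false xs (λ y y∈ → e y (there y∈)))

  any-false⁻ : ∀ {p : A → Bool} xs → any p xs ≡ false → ∀ x → x ∈ xs → p x ≡ false
  any-false⁻ {p = p} (y ∷ xs) e x (here refl) = Boolₚ.∨-conicalˡ (p y) _ e
  any-false⁻ {p = p} (y ∷ xs) e x (there x∈) = any-false⁻ xs (Boolₚ.∨-conicalʳ (p y) _ e) x x∈

  All⇒∉ : ∀ {P : A → Set} {xs v} → All P xs → ¬ P v → v ∉ xs
  All⇒∉ (p All.∷ _) ¬p (here refl) = ¬p p
  All⇒∉ (_ All.∷ ps) ¬p (there v∈) = All⇒∉ ps ¬p v∈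

  Unique-head : ∀ {x : A} {xs} → Unique (x ∷ xs) → x ∉ xs
  Unique-head (x≢xs ∷ _) = All¬⇒¬Any x≢xs

  Unique-tail : ∀ {x : A} {xs} → Unique (x ∷ xs) → Unique xs
  Unique-tail (_ ∷ u) = u

  ∉⇒All≢ : ∀ {y : A} {xs} → y ∉ xs → All (y ≢_) xs
  ∉⇒All≢ = ¬Any⇒All¬ _

  Unique-concatMap : ∀ (f : A → List B) xs → Unique xs → (∀ x → Unique (f x)) →
    (∀ x x′ y → y ∈ f x → y ∈ f x′ → x ≡ x′) → Unique (concatMap f xs)
  Unique-concatMap f [] _ _ _ = []
  Unique-concatMap f (x ∷ xs) u uf determined = Uniqueₚ.++⁺ (uf x) (Unique-concatMap f xs (Unique-tail u) uf determined) disjoint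
    where
    disjoint : ∀ {v} → ¬ (v ∈ f x × v ∈ concatMap f xs)
    disjoint (v∈fx , v∈rest) with find (∈-concatMap⁻ f {xs = xs} v∈rest)
    ... | x′ , x′∈ , v∈fx′ = Unique-head u (≡.subst (_∈ xs) (≡.sym (determined x x′ _ v∈fx v∈fx′)) x′∈)

  Unique-⊆⇒length≤ : ∀ {xs ys : List A} → Unique xs → (∀ {x} → x ∈ xs → x ∈ ys) → length xs ≤ length ys
  Unique-⊆⇒length≤ {xs = []} u sub = z≤n
  Unique-⊆⇒length≤ {xs = x ∷ xs} {ys} u sub with ∈-∃++ (sub (here refl))
  ... | ys₁ , ys₂ , refl = ≡.subst (suc (length xs) ≤_) (≡.sym length-ys) (s≤s (Unique-⊆⇒length≤ (Unique-tail u) sub′))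
    where
    length-ys : length (ys₁ ++ x ∷ ys₂) ≡ suc (length (ys₁ ++ ys₂))
    length-ys = ≡.trans (Listₚ.length-++ ys₁) (≡.trans (ℕₚ.+-suc (length ys₁) (length ys₂)) (≡.cong suc (≡.sym (Listₚ.length-++ ys₁))))
    sub′ : ∀ {y} → y ∈ xs → y ∈ ys₁ ++ ys₂
    sub′ {y} y∈ with ∈-++⁻ ys₁ (sub (there y∈))
    ... | inj₁ y∈ys₁ = ∈-++⁺ˡ y∈ys₁
    ... | inj₂ (here refl) = ⊥-elim (Unique-head u y∈)
    ... | inj₂ (there y∈ys₂) = ∈-++⁺ʳ ys₁ y∈ys₂

  Unique-⊆-length≥⇒⊇ : ∀ {xs ys : List ℕ} → Unique xs → (∀ {x} → x ∈ xs → x ∈ ys) → length ys ≤ length xs →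
    ∀ {y} → y ∈ ys → y ∈ xs
  Unique-⊆-length≥⇒⊇ {xs} {ys} u sub ys≤xs {y} y∈ with y ∈? xs
  ... | yes y∈xs = y∈xs
  ... | no y∉xs = ⊥-elim (ℕₚ.<⇒≱ (Unique-⊆⇒length≤ {xs = y ∷ xs} (∉⇒All≢ y∉xs ∷ u) sub′) ys≤xs)
    where
    sub′ : ∀ {x} → x ∈ y ∷ xs → x ∈ ys
    sub′ (here refl) = y∈
    sub′ (there x∈) = sub x∈

module Patterns where

  open import Data.Bool using (Bool; true; false; T; _∧_; _∨_; not; if_then_else_)
  import Data.Bool.Properties as Boolₚ
  open Boolₚ using (∨-conicalˡ; ∨-conicalʳ)
  open import Data.Bool.ListAction using (any)
  open import Data.List using (List; []; _∷_; [_]; _++_; map; length)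
  import Data.List.Properties as Listₚ
  open import Data.List.Membership.Propositional using (_∈_)
  open import Data.List.Membership.Propositional.Properties using (∈-∃++)
  open import Data.List.Relation.Unary.All as All using (All; []; _∷_)
  open import Data.Nat as ℕ using (ℕ; zero; suc; _+_; _≤_; _<_; _<ᵇ_; _≡ᵇ_)
  import Data.Nat.Properties as ℕₚ
  open import Data.Product using (_,_)
  open import Function using (_∘_)
  open import Function.Bundles using (Equivalence)
  open import Relation.Binary.PropositionalEquality as ≡ using (_≡_; _≢_; refl)
  open import Relation.Nullary using (¬_)
  open import Defs using (sublists; is132; avoids132; incr; occ)
  open Lists

  <ᵇ-false : ∀ {a b} → b ≤ a → (a <ᵇ b) ≡ false
  <ᵇ-false {a} {b} b≤a = Boolₚ.¬-not (λ a<ᵇb → ℕₚ.<⇒≱ (ℕₚ.<ᵇ⇒< a b (Equivalence.from Boolₚ.T-≡ a<ᵇb)) b≤a)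

  <ᵇ-true : ∀ {a b} → a < b → (a <ᵇ b) ≡ true
  <ᵇ-true a<b = Equivalence.to Boolₚ.T-≡ (ℕₚ.<⇒<ᵇ a<b)

  <ᵇ-+ : ∀ c a b → (c + a <ᵇ c + b) ≡ (a <ᵇ b)
  <ᵇ-+ zero a b = refl
  <ᵇ-+ (suc c) a b = <ᵇ-+ c a b

  any-sublists-∷ : ∀ (p : List ℕ → Bool) x xs → any p (sublists (x ∷ xs)) ≡ any (p ∘ (x ∷_)) (sublists xs) ∨ any p (sublists xs)
  any-sublists-∷ p x xs = ≡.trans (any-++ p (map (x ∷_) (sublists xs)) (sublists xs)) (≡.cong (_∨ _) (any-map p (x ∷_) (sublists xs)))

  count-sublists-∷ : ∀ (p : List ℕ → Bool) x xs → count p (sublists (x ∷ xs)) ≡ count (p ∘ (x ∷_)) (sublists xs) + count p (sublists xs)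
  count-sublists-∷ p x xs = ≡.trans (count-++ p (map (x ∷_) (sublists xs)) (sublists xs)) (≡.cong (_+ _) (count-map p (x ∷_) (sublists xs)))

  has32Above : ℕ → List ℕ → Bool
  has32Above x [] = false
  has32Above x (y ∷ ys) = any (λ z → (x <ᵇ z) ∧ (z <ᵇ y)) ys ∨ has32Above x ys

  has132 : List ℕ → Bool
  has132 [] = false
  has132 (x ∷ xs) = has32Above x xs ∨ has132 xs

  avoids132≡not-has132 : ∀ w → avoids132 w ≡ not (has132 w)
  avoids132≡not-has132 w = ≡.cong not (any-is132 w)
    where
    any-is132-xyz : ∀ x y z zs → any (λ s → is132 (x ∷ y ∷ z ∷ s)) (sublists zs) ≡ (x <ᵇ z) ∧ (z <ᵇ y)
    any-is132-xyz x y z [] = Boolₚ.∨-identityʳ _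
    any-is132-xyz x y z (w ∷ ws) = ≡.trans (any-sublists-∷ (λ s → is132 (x ∷ y ∷ z ∷ s)) w ws)
      (≡.cong₂ _∨_ (any-false (sublists ws) (λ _ _ → refl)) (any-is132-xyz x y z ws))
    any-is132-xy : ∀ x y zs → any (λ s → is132 (x ∷ y ∷ s)) (sublists zs) ≡ any (λ z → (x <ᵇ z) ∧ (z <ᵇ y)) zs
    any-is132-xy x y [] = refl
    any-is132-xy x y (z ∷ zs) = ≡.trans (any-sublists-∷ _ z zs) (≡.cong₂ _∨_ (any-is132-xyz x y z zs) (any-is132-xy x y zs))
    any-is132-x : ∀ x ys → any (λ s → is132 (x ∷ s)) (sublists ys) ≡ has32Above x ys
    any-is132-x x [] = refl
    any-is132-x x (y ∷ ys) = ≡.trans (any-sublists-∷ _ y ys) (≡.cong₂ _∨_ (any-is132-xy x y ys) (any-is132-x x ys))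
    any-is132 : ∀ w → any is132 (sublists w) ≡ has132 w
    any-is132 [] = refl
    any-is132 (x ∷ xs) = ≡.trans (any-sublists-∷ is132 x xs) (≡.cong₂ _∨_ (any-is132-x x xs) (any-is132 xs))

  T-avoids132⇒has132≡false : ∀ w → T (avoids132 w) → has132 w ≡ false
  T-avoids132⇒has132≡false w avoids rewrite avoids132≡not-has132 w with has132 w
  ... | false = refl

  has32Above-below : ∀ {x} ys → All (_< x) ys → has32Above x ys ≡ false
  has32Above-below [] _ = refl
  has32Above-below {x} (y ∷ ys) (_ ∷ ys<x) = ≡.cong₂ _∨_
    (any-false ys (λ z z∈ → ≡.cong (_∧ (z <ᵇ y)) (<ᵇ-false (ℕₚ.<⇒≤ (All.lookup ys<x z∈)))))
    (has32Above-below ys ys<x)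

  has32Above-++-below : ∀ {x} X Y → All (_< x) Y → has32Above x (X ++ Y) ≡ has32Above x X
  has32Above-++-below [] Y Y<x = has32Above-below Y Y<x
  has32Above-++-below {x} (y ∷ X) Y Y<x = ≡.cong₂ _∨_
    (≡.trans (any-++ _ X Y) (≡.trans (≡.cong (any _ X ∨_) (any-false Y (λ z z∈ → ≡.cong (_∧ (z <ᵇ y)) (<ᵇ-false (ℕₚ.<⇒≤ (All.lookup Y<x z∈))))))
      (Boolₚ.∨-identityʳ _)))
    (has32Above-++-below X Y Y<x)

  has132-++ : ∀ X Y → All (λ a → All (_< a) Y) X → has132 (X ++ Y) ≡ has132 X ∨ has132 Y
  has132-++ [] Y _ = refl
  has132-++ (x ∷ X) Y (Y<x ∷ Y<X) =
    ≡.trans (≡.cong₂ _∨_ (has32Above-++-below X Y Y<x) (has132-++ X Y Y<X)) (≡.sym (Boolₚ.∨-assoc (has32Above x X) _ _))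

  has32Above-∷ʳ : ∀ {x m} X → All (_< m) X → has32Above x (X ++ [ m ]) ≡ has32Above x X
  has32Above-∷ʳ [] _ = refl
  has32Above-∷ʳ {x} {m} (y ∷ X) (y<m ∷ X<m) = ≡.cong₂ _∨_
    (≡.trans (any-++ _ X [ m ]) (≡.trans (≡.cong (λ b → any _ X ∨ (b ∨ false))
      (≡.trans (≡.cong ((x <ᵇ m) ∧_) (<ᵇ-false (ℕₚ.<⇒≤ y<m))) (Boolₚ.∧-zeroʳ _))) (Boolₚ.∨-identityʳ _)))
    (has32Above-∷ʳ X X<m)

  has132-∷ʳ : ∀ {m} X → All (_< m) X → has132 (X ++ [ m ]) ≡ has132 X
  has132-∷ʳ [] _ = refl
  has132-∷ʳ (x ∷ X) (_ ∷ X<m) = ≡.cong₂ _∨_ (has32Above-∷ʳ X X<m) (has132-∷ʳ X X<m)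

  has32Above-+ : ∀ c x ys → has32Above (c + x) (map (c +_) ys) ≡ has32Above x ys
  has32Above-+ c x [] = refl
  has32Above-+ c x (y ∷ ys) = ≡.cong₂ _∨_
    (≡.trans (any-map _ (c +_) ys) (any-cong ys (λ z → ≡.cong₂ _∧_ (<ᵇ-+ c x z) (<ᵇ-+ c z y))))
    (has32Above-+ c x ys)

  has132-+ : ∀ c xs → has132 (map (c +_) xs) ≡ has132 xs
  has132-+ c [] = refl
  has132-+ c (x ∷ xs) = ≡.cong₂ _∨_ (has32Above-+ c x xs) (has132-+ c xs)

  has32Above-++⁻ʳ : ∀ {x} X Y → has32Above x (X ++ Y) ≡ false → has32Above x Y ≡ false
  has32Above-++⁻ʳ [] Y e = e
  has32Above-++⁻ʳ (y ∷ X) Y e = has32Above-++⁻ʳ X Y (∨-conicalʳ _ _ e)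

  has32Above-++⁻ˡ : ∀ {x} X Y → has32Above x (X ++ Y) ≡ false → has32Above x X ≡ false
  has32Above-++⁻ˡ [] Y e = refl
  has32Above-++⁻ˡ (y ∷ X) Y e = ≡.cong₂ _∨_
    (∨-conicalˡ _ _ (≡.trans (≡.sym (any-++ _ X Y)) (∨-conicalˡ _ _ e)))
    (has32Above-++⁻ˡ X Y (∨-conicalʳ _ _ e))

  has132-++⁻ˡ : ∀ X Y → has132 (X ++ Y) ≡ false → has132 X ≡ false
  has132-++⁻ˡ [] Y e = refl
  has132-++⁻ˡ (x ∷ X) Y e = ≡.cong₂ _∨_ (has32Above-++⁻ˡ X Y (∨-conicalˡ _ _ e)) (has132-++⁻ˡ X Y (∨-conicalʳ _ _ e))

  has132-++⁻ʳ : ∀ X Y → has132 (X ++ Y) ≡ false → has132 Y ≡ false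
  has132-++⁻ʳ [] Y e = e
  has132-++⁻ʳ (x ∷ X) Y e = has132-++⁻ʳ X Y (∨-conicalʳ _ _ e)

  no-ascent-across : ∀ A m B {a b} → has132 (A ++ m ∷ B) ≡ false → a ∈ A → b ∈ B → b < m → ¬ a < b
  no-ascent-across A m B {a} {b} avoids a∈A b∈B b<m a<b with ∈-∃++ a∈A
  ... | A₁ , A₂ , refl = true≢false (≡.trans (≡.sym (≡.cong₂ _∧_ (<ᵇ-true a<b) (<ᵇ-true b<m))) a-b-m-absent)
    where
    true≢false : true ≢ false
    true≢false ()
    avoids′ : has132 (a ∷ (A₂ ++ m ∷ B)) ≡ false
    avoids′ = has132-++⁻ʳ A₁ (a ∷ A₂ ++ m ∷ B) (≡.subst (λ w → has132 w ≡ false) (Listₚ.++-assoc A₁ (a ∷ A₂) (m ∷ B)) avoids)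
    a-b-m-absent : ((a <ᵇ b) ∧ (b <ᵇ m)) ≡ false
    a-b-m-absent = any-false⁻ B (∨-conicalˡ _ _ (has32Above-++⁻ʳ A₂ (m ∷ B) (∨-conicalˡ _ _ avoids′))) b b∈B

  increasingAbove : ℕ → ℕ → List ℕ → ℕ
  increasingAbove zero b xs = 1
  increasingAbove (suc i) b [] = 0
  increasingAbove (suc i) b (x ∷ xs) = (if b <ᵇ x then increasingAbove i x xs else 0) + increasingAbove (suc i) b xs

  increasing : ℕ → List ℕ → ℕ
  increasing zero xs = 1
  increasing (suc i) [] = 0
  increasing (suc i) (x ∷ xs) = increasingAbove i x xs + increasing (suc i) xs

  occ≡increasing : ∀ i w → occ i w ≡ increasing i w
  occ≡increasing i w = ≡.trans (length-filterᵇ _ (sublists w)) (count-increasing i w)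
    where
    count-empty : ∀ (g : List ℕ → Bool) xs → count (λ s → (length s ≡ᵇ 0) ∧ g s) (sublists xs) ≡ (if g [] then 1 else 0)
    count-empty g [] with g []
    ... | true = refl
    ... | false = refl
    count-empty g (x ∷ xs) = ≡.trans (count-sublists-∷ _ x xs)
      (≡.cong₂ _+_ (count-false (sublists xs) (λ _ → refl)) (count-empty g xs))
    count-above : ∀ i b xs → count (λ s → (length s ≡ᵇ i) ∧ incr (b ∷ s)) (sublists xs) ≡ increasingAbove i b xs
    count-above zero b xs = count-empty (λ s → incr (b ∷ s)) xs
    count-above (suc i) b [] = refl
    count-above (suc i) b (x ∷ xs) = ≡.trans (count-sublists-∷ _ x xs) (≡.cong₂ _+_ headed (count-above (suc i) b xs))
      where
      headed : count (λ s → (length s ≡ᵇ i) ∧ ((b <ᵇ x) ∧ incr (x ∷ s))) (sublists xs) ≡ (if b <ᵇ x then increasingAbove i x xs else 0)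
      headed with b <ᵇ x
      ... | true = count-above i x xs
      ... | false = count-false (sublists xs) (λ s → Boolₚ.∧-zeroʳ (length s ≡ᵇ i))
    count-increasing : ∀ i w → count (λ s → (length s ≡ᵇ i) ∧ incr s) (sublists w) ≡ increasing i w
    count-increasing zero w = count-empty incr w
    count-increasing (suc i) [] = refl
    count-increasing (suc i) (x ∷ xs) = ≡.trans (count-sublists-∷ _ x xs) (≡.cong₂ _+_ (count-above i x xs) (count-increasing (suc i) xs))

  private
    open import Algebra.Properties.CommutativeSemigroup ℕₚ.+-commutativeSemigroup using (interchange)

    if-+ : ∀ (c : Bool) a b → (if c then a + b else 0) ≡ (if c then a else 0) + (if c then b else 0)
    if-+ true a b = refl
    if-+ false a b = refl

  increasingAbove-below : ∀ i b Y → All (_≤ b) Y → increasingAbove (suc i) b Y ≡ 0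
  increasingAbove-below i b [] _ = refl
  increasingAbove-below i b (y ∷ Y) (y≤b ∷ Y≤b) rewrite <ᵇ-false y≤b = increasingAbove-below i b Y Y≤b

  increasingAbove-++ : ∀ i b X Y → All (λ a → All (_< a) Y) X →
    increasingAbove (suc i) b (X ++ Y) ≡ increasingAbove (suc i) b X + increasingAbove (suc i) b Y
  increasingAbove-++-below : ∀ i x X Y → All (λ a → All (_< a) Y) X → All (_< x) Y →
    increasingAbove (suc i) x (X ++ Y) ≡ increasingAbove (suc i) x X

  increasingAbove-++ i b [] Y _ = refl
  increasingAbove-++ zero b (x ∷ X) Y (_ ∷ Y<X) =
    ≡.trans (≡.cong ((if b <ᵇ x then 1 else 0) +_) (increasingAbove-++ zero b X Y Y<X)) (≡.sym (ℕₚ.+-assoc (if b <ᵇ x then 1 else 0) _ _))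
  increasingAbove-++ (suc i) b (x ∷ X) Y (Y<x ∷ Y<X) =
    ≡.trans (≡.cong₂ _+_ (≡.cong (λ n → if b <ᵇ x then n else 0) (increasingAbove-++-below i x X Y Y<X Y<x)) (increasingAbove-++ (suc i) b X Y Y<X))
      (≡.sym (ℕₚ.+-assoc (if b <ᵇ x then increasingAbove (suc i) x X else 0) _ _))

  increasingAbove-++-below i x X Y Y<X Y<x = ≡.trans (increasingAbove-++ i x X Y Y<X)
    (≡.trans (≡.cong (increasingAbove (suc i) x X +_) (increasingAbove-below i x Y (All.map ℕₚ.<⇒≤ Y<x))) (ℕₚ.+-identityʳ _))

  increasing-++ : ∀ i X Y → All (λ a → All (_< a) Y) X → increasing (suc i) (X ++ Y) ≡ increasing (suc i) X + increasing (suc i) Y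
  increasing-++ i [] Y _ = refl
  increasing-++ zero (x ∷ X) Y (_ ∷ Y<X) = ≡.cong suc (increasing-++ zero X Y Y<X)
  increasing-++ (suc i) (x ∷ X) Y (Y<x ∷ Y<X) =
    ≡.trans (≡.cong₂ _+_ (increasingAbove-++-below i x X Y Y<X Y<x) (increasing-++ (suc i) X Y Y<X))
      (≡.sym (ℕₚ.+-assoc (increasingAbove (suc i) x X) _ _))

  increasingAbove-[] : ∀ i b b′ → increasingAbove i b [] ≡ increasingAbove i b′ []
  increasingAbove-[] zero b b′ = refl
  increasingAbove-[] (suc i) b b′ = refl

  increasingAbove-∷ʳ : ∀ i b m X → b < m → All (_< m) X →
    increasingAbove (suc i) b (X ++ [ m ]) ≡ increasingAbove (suc i) b X + increasingAbove i b X
  increasingAbove-∷ʳ i b m [] b<m _ rewrite <ᵇ-true b<m = ≡.trans (ℕₚ.+-identityʳ _) (increasingAbove-[] i m b)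
  increasingAbove-∷ʳ zero b m (x ∷ X) b<m (_ ∷ X<m) =
    ≡.trans (≡.cong ((if b <ᵇ x then 1 else 0) +_) (increasingAbove-∷ʳ zero b m X b<m X<m)) (≡.sym (ℕₚ.+-assoc (if b <ᵇ x then 1 else 0) _ 1))
  increasingAbove-∷ʳ (suc i) b m (x ∷ X) b<m (x<m ∷ X<m) =
    ≡.trans (≡.cong₂ _+_ (≡.trans (≡.cong (λ n → if b <ᵇ x then n else 0) (increasingAbove-∷ʳ i x m X x<m X<m)) (if-+ (b <ᵇ x) _ _))
                         (increasingAbove-∷ʳ (suc i) b m X b<m X<m))
      (interchange (if b <ᵇ x then increasingAbove (suc i) x X else 0) (if b <ᵇ x then increasingAbove i x X else 0)
                   (increasingAbove (suc (suc i)) b X) (increasingAbove (suc i) b X))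

  increasing-∷ʳ : ∀ i m X → All (_< m) X → increasing (suc i) (X ++ [ m ]) ≡ increasing (suc i) X + increasing i X
  increasing-∷ʳ zero m [] _ = refl
  increasing-∷ʳ (suc i) m [] _ = refl
  increasing-∷ʳ zero m (x ∷ X) (_ ∷ X<m) = ≡.trans (≡.cong suc (increasing-∷ʳ zero m X X<m)) (≡.sym (ℕₚ.+-assoc 1 (increasing 1 X) 1))
  increasing-∷ʳ (suc i) m (x ∷ X) (x<m ∷ X<m) =
    ≡.trans (≡.cong₂ _+_ (increasingAbove-∷ʳ i x m X x<m X<m) (increasing-∷ʳ (suc i) m X X<m))
      (interchange (increasingAbove (suc i) x X) (increasingAbove i x X) (increasing (suc (suc i)) X) (increasing (suc i) X))

  increasingAbove-+ : ∀ i c b X → increasingAbove i (c + b) (map (c +_) X) ≡ increasingAbove i b X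
  increasingAbove-+ zero c b X = refl
  increasingAbove-+ (suc i) c b [] = refl
  increasingAbove-+ (suc i) c b (x ∷ X) rewrite <ᵇ-+ c b x | increasingAbove-+ i c x X | increasingAbove-+ (suc i) c b X = refl

  increasing-+ : ∀ i c X → increasing i (map (c +_) X) ≡ increasing i X
  increasing-+ zero c X = refl
  increasing-+ (suc i) c [] = refl
  increasing-+ (suc i) c (x ∷ X) rewrite increasingAbove-+ i c x X | increasing-+ (suc i) c X = refl

module Permutations where

  open import Data.Bool using (Bool; true; false; not)
  open import Data.Bool.Properties using (T-≡; ∧-conicalˡ; ∧-conicalʳ)
  open import Data.Empty using (⊥-elim)
  open import Data.List using (List; []; _∷_; map; length; upTo)
  import Data.List.Properties as Listₚ
  open import Data.List.Membership.Propositional using (_∈_; _∉_; lose; find)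
  open import Data.List.Membership.Propositional.Properties
    using (∈-concatMap⁺; ∈-concatMap⁻; ∈-map⁺; ∈-map⁻; ∈-upTo⁺; ∈-upTo⁻; ∈-filter⁺; ∈-filter⁻)
  open import Data.List.Relation.Unary.All as All using (All; []; _∷_)
  open import Data.List.Relation.Unary.Any using (here; there)
  open import Data.List.Relation.Unary.AllPairs using ([]; _∷_)
  open import Data.List.Relation.Unary.Unique.Propositional using (Unique)
  import Data.List.Relation.Unary.Unique.Propositional.Properties as Uniqueₚ
  open import Data.Nat using (ℕ; zero; suc; _≤_; _<_; _≡ᵇ_)
  import Data.Nat.Properties as ℕₚ
  open import Data.Product using (_×_; _,_)
  open import Function using (_∘_)
  open import Function.Bundles using (Equivalence)
  open import Relation.Binary.PropositionalEquality as ≡ using (_≡_; _≢_; refl)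
  open import Relation.Nullary.Decidable using (T?)
  open import Defs using (words; perms; distinct; elemᵇ)
  open Lists

  record IsPermutation (n : ℕ) (w : List ℕ) : Set where
    field
      length≡ : length w ≡ n
      bounded : All (_< n) w
      unique : Unique w

    contains : ∀ {v} → v < n → v ∈ w
    contains v<n = Unique-⊆-length≥⇒⊇ unique (λ v∈w → ∈-upTo⁺ (All.lookup bounded v∈w))
      (≡.subst (_≤ length w) (≡.sym (Listₚ.length-upTo n)) (ℕₚ.≤-reflexive (≡.sym length≡))) (∈-upTo⁺ v<n)

  ∈words⁺ : ∀ n m {w} → length w ≡ n → All (_< m) w → w ∈ words n m
  ∈words⁺ zero m {[]} refl [] = here refl
  ∈words⁺ (suc n) m {a ∷ w} length≡ (a<m ∷ w<m) = ∈-concatMap⁺ (λ a → map (a ∷_) (words n m))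
    (lose (∈-upTo⁺ a<m) (∈-map⁺ (a ∷_) (∈words⁺ n m (ℕₚ.suc-injective length≡) w<m)))

  ∈words⁻ : ∀ n m {w} → w ∈ words n m → length w ≡ n × All (_< m) w
  ∈words⁻ zero m (here refl) = refl , []
  ∈words⁻ (suc n) m w∈ with find (∈-concatMap⁻ (λ a → map (a ∷_) (words n m)) {xs = upTo m} w∈)
  ... | a , a∈ , aw∈ with ∈-map⁻ (a ∷_) aw∈
  ... | w , w∈ , refl with ∈words⁻ n m w∈
  ... | length≡ , w<m = ≡.cong suc length≡ , ∈-upTo⁻ a∈ ∷ w<m

  words-unique : ∀ n m → Unique (words n m)
  words-unique zero m = [] ∷ []
  words-unique (suc n) m = Unique-concatMap (λ a → map (a ∷_) (words n m)) (upTo m) (Uniqueₚ.upTo⁺ m)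
    (λ a → Uniqueₚ.map⁺ Listₚ.∷-injectiveʳ (words-unique n m)) same-head
    where
    same-head : ∀ a a′ w → w ∈ map (a ∷_) (words n m) → w ∈ map (a′ ∷_) (words n m) → a ≡ a′
    same-head a a′ w w∈ w∈′ with ∈-map⁻ (a ∷_) w∈ | ∈-map⁻ (a′ ∷_) w∈′
    ... | _ , _ , refl | _ , _ , e = Listₚ.∷-injectiveˡ e

  private
    true≢false : true ≢ false
    true≢false ()

  elemᵇ-false⁺ : ∀ x xs → x ∉ xs → elemᵇ x xs ≡ false
  elemᵇ-false⁺ x [] _ = refl
  elemᵇ-false⁺ x (y ∷ ys) x∉ with x ≡ᵇ y in x≡ᵇy
  ... | true = ⊥-elim (x∉ (here (ℕₚ.≡ᵇ⇒≡ x y (Equivalence.from T-≡ x≡ᵇy))))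
  ... | false = elemᵇ-false⁺ x ys (x∉ ∘ there)

  elemᵇ-false⁻ : ∀ x xs → elemᵇ x xs ≡ false → x ∉ xs
  elemᵇ-false⁻ x (y ∷ ys) e x∈ with x ≡ᵇ y in x≡ᵇy | x∈
  ... | true | _ = true≢false e
  ... | false | here refl = true≢false (≡.trans (≡.sym (Equivalence.to T-≡ (ℕₚ.≡⇒≡ᵇ x x refl))) x≡ᵇy)
  ... | false | there x∈ys = elemᵇ-false⁻ x ys e x∈ys

  distinct⇒Unique : ∀ w → distinct w ≡ true → Unique w
  distinct⇒Unique [] _ = []
  distinct⇒Unique (x ∷ xs) e =
    ∉⇒All≢ (elemᵇ-false⁻ x xs (not-true (∧-conicalˡ _ _ e))) ∷ distinct⇒Unique xs (∧-conicalʳ _ _ e)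
    where
    not-true : ∀ {b} → not b ≡ true → b ≡ false
    not-true {false} _ = refl

  Unique⇒distinct : ∀ w → Unique w → distinct w ≡ true
  Unique⇒distinct [] _ = refl
  Unique⇒distinct (x ∷ xs) u rewrite elemᵇ-false⁺ x xs (Unique-head u) = Unique⇒distinct xs (Unique-tail u)

  ∈perms⁺ : ∀ {n w} → IsPermutation n w → w ∈ perms n
  ∈perms⁺ {n} {w} perm = ∈-filter⁺ (T? ∘ distinct) (∈words⁺ n n length≡ bounded) (Equivalence.from T-≡ (Unique⇒distinct w unique))
    where open IsPermutation perm

  ∈perms⁻ : ∀ {n w} → w ∈ perms n → IsPermutation n w
  ∈perms⁻ {n} {w} w∈ with ∈-filter⁻ (T? ∘ distinct) {xs = words n n} w∈
  ... | w∈words , distinct-w with ∈words⁻ n n w∈words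
  ... | length≡ , bounded = record { length≡ = length≡ ; bounded = bounded ; unique = distinct⇒Unique w (Equivalence.to T-≡ distinct-w) }

  perms-unique : ∀ n → Unique (perms n)
  perms-unique n = Uniqueₚ.filter⁺ (T? ∘ distinct) (words-unique n n)

module Trees where

  open import Data.Bool using (false; _∨_)
  open import Data.Empty using (⊥-elim)
  open import Data.List using (List; []; _∷_; [_]; _++_; map; length; upTo)
  import Data.List.Properties as Listₚ
  open import Data.List.Membership.Propositional using (_∈_; _∉_)
  open import Data.List.Membership.Propositional.Properties using (∈-∃++; ∈-++⁻; ∈-++⁺ˡ; ∈-++⁺ʳ; ∈-upTo⁻)
  open import Data.List.Relation.Unary.All as All using (All; []; _∷_)
  import Data.List.Relation.Unary.All.Properties as Allₚ
  open import Data.List.Relation.Unary.Any using (here; there)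
  open import Data.List.Relation.Unary.AllPairs using ([]; _∷_)
  open import Data.List.Relation.Unary.Unique.Propositional using (Unique)
  import Data.List.Relation.Unary.Unique.Propositional.Properties as Uniqueₚ
  open import Data.Nat as ℕ using (ℕ; zero; suc; _+_; _∸_; _≤_; _<_; s≤s)
  import Data.Nat.Properties as ℕₚ
  open import Data.Nat.Combinatorics using (_C_; nCk+nC[k+1]≡[n+1]C[k+1])
  open import Data.Product using (∃; _×_; _,_)
  open import Data.Sum using (inj₁; inj₂)
  open import Relation.Binary.Definitions using (tri<; tri≈; tri>)
  open import Relation.Binary.PropositionalEquality as ≡ using (_≡_; _≢_; refl)
  open import Relation.Nullary using (¬_; yes; no)
  open Lists
  open Patterns
  open Permutations using (IsPermutation; module IsPermutation)

  data Tree : Set where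
    leaf : Tree
    node : Tree → Tree → Tree

  size : Tree → ℕ
  size leaf = 0
  size (node l r) = suc (size l + size r)

  toPerm : Tree → List ℕ
  toPerm leaf = []
  toPerm (node l r) = map (size r +_) (toPerm l) ++ (size l + size r) ∷ toPerm r

  length-toPerm : ∀ t → length (toPerm t) ≡ size t
  length-toPerm leaf = refl
  length-toPerm (node l r) = ≡.trans (Listₚ.length-++ (map (size r +_) (toPerm l)))
    (≡.trans (≡.cong₂ (λ a b → a + suc b) (≡.trans (Listₚ.length-map _ (toPerm l)) (length-toPerm l)) (length-toPerm r))
      (ℕₚ.+-suc (size l) (size r)))

  toPerm-bounded : ∀ t → All (_< size t) (toPerm t)
  left-below : ∀ l r → All (_< size l + size r) (map (size r +_) (toPerm l))
  right-below : ∀ l r → All (_< size l + size r) (toPerm r)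

  toPerm-bounded leaf = []
  toPerm-bounded (node l r) = Allₚ.++⁺ (All.map ℕₚ.m<n⇒m<1+n (left-below l r)) (ℕₚ.n<1+n _ ∷ All.map ℕₚ.m<n⇒m<1+n (right-below l r))

  left-below l r = Allₚ.map⁺ (All.map (λ {v} v<l → ≡.subst (size r + v <_) (ℕₚ.+-comm (size r) (size l)) (ℕₚ.+-monoʳ-< (size r) v<l))
    (toPerm-bounded l))

  right-below l r = All.map (λ v<r → ℕₚ.<-≤-trans v<r (ℕₚ.m≤n+m (size r) (size l))) (toPerm-bounded r)

  left-above : ∀ l r → All (size r ≤_) (map (size r +_) (toPerm l))
  left-above l r = Allₚ.map⁺ (All.universal (ℕₚ.m≤m+n (size r)) (toPerm l))

  left-above-right : ∀ l r → All (λ a → All (_< a) (toPerm r)) (map (size r +_) (toPerm l) ++ [ size l + size r ])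
  left-above-right l r = Allₚ.++⁺ (All.map (λ r≤a → All.map (λ v<r → ℕₚ.<-≤-trans v<r r≤a) (toPerm-bounded r)) (left-above l r))
    (right-below l r ∷ [])

  toPerm-node : ∀ l r → toPerm (node l r) ≡ (map (size r +_) (toPerm l) ++ [ size l + size r ]) ++ toPerm r
  toPerm-node l r = ≡.sym (Listₚ.++-assoc (map (size r +_) (toPerm l)) [ size l + size r ] (toPerm r))

  toPerm-unique : ∀ t → Unique (toPerm t)
  toPerm-unique leaf = []
  toPerm-unique (node l r) = Uniqueₚ.++⁺ (Uniqueₚ.map⁺ (ℕₚ.+-cancelˡ-≡ (size r) _ _) (toPerm-unique l))
    (∉⇒All≢ (All⇒∉ (right-below l r) (ℕₚ.<-irrefl refl)) ∷ toPerm-unique r) disjoint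
    where
    disjoint : ∀ {v} → ¬ (v ∈ map (size r +_) (toPerm l) × v ∈ (size l + size r) ∷ toPerm r)
    disjoint (v∈l , here refl) = All⇒∉ (left-below l r) (ℕₚ.<-irrefl refl) v∈l
    disjoint (v∈l , there v∈r) = ℕₚ.<⇒≱ (All.lookup (toPerm-bounded r) v∈r) (All.lookup (left-above l r) v∈l)

  toPerm-isPermutation : ∀ t → IsPermutation (size t) (toPerm t)
  toPerm-isPermutation t = record { length≡ = length-toPerm t ; bounded = toPerm-bounded t ; unique = toPerm-unique t }

  toPerm-avoids132 : ∀ t → has132 (toPerm t) ≡ false
  toPerm-avoids132 leaf = refl
  toPerm-avoids132 (node l r) = ≡.trans (≡.cong has132 (toPerm-node l r))
    (≡.trans (has132-++ _ (toPerm r) (left-above-right l r))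
      (≡.cong₂ _∨_ (≡.trans (has132-∷ʳ _ (left-below l r)) (≡.trans (has132-+ (size r) (toPerm l)) (toPerm-avoids132 l)))
                   (toPerm-avoids132 r)))

  -- toPerm lists the nodes in order, so the entries after a node and above it are the d ancestors
  -- whose left subtree contains it, in increasing order: the node starts exactly C(d, i) occurrences
  -- of 12…(i+1).
  weight : ℕ → ℕ → Tree → ℕ
  weight i d leaf = 0
  weight i d (node l r) = d C i + weight i (suc d) l + weight i d r

  weight-0 : ∀ d t → weight 0 d t ≡ size t
  weight-0 d leaf = refl
  weight-0 d (node l r) = ≡.cong suc (≡.cong₂ _+_ (weight-0 (suc d) l) (weight-0 d r))

  weight-pascal : ∀ i d t → weight (suc i) (suc d) t ≡ weight (suc i) d t + weight i d t
  weight-pascal i d leaf = refl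
  weight-pascal i d (node l r) rewrite weight-pascal i (suc d) l | weight-pascal i d r | ≡.sym (nCk+nC[k+1]≡[n+1]C[k+1] d i) =
    solve 6 (λ a b c e f g → ((a :+ b) :+ (c :+ e)) :+ (f :+ g) := ((b :+ c) :+ f) :+ ((a :+ e) :+ g)) refl
      (d C i) (d C suc i) (weight (suc i) (suc d) l) (weight i (suc d) l) (weight (suc i) d r) (weight i d r)
    where
    open import Data.Nat.Solver using (module +-*-Solver)
    open +-*-Solver

  increasing-toPerm : ∀ i t → increasing (suc i) (toPerm t) ≡ weight i 0 t
  increasing-toPerm i leaf = refl
  increasing-toPerm i (node l r) = begin
    increasing (suc i) (toPerm (node l r))
      ≡⟨ ≡.cong (increasing (suc i)) (toPerm-node l r) ⟩
    increasing (suc i) ((map (size r +_) (toPerm l) ++ [ size l + size r ]) ++ toPerm r)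
      ≡⟨ increasing-++ i _ (toPerm r) (left-above-right l r) ⟩
    increasing (suc i) (map (size r +_) (toPerm l) ++ [ size l + size r ]) + increasing (suc i) (toPerm r)
      ≡⟨ ≡.cong₂ _+_ (≡.trans (increasing-∷ʳ i _ _ (left-below l r))
                       (≡.cong₂ _+_ (increasing-+ (suc i) (size r) (toPerm l)) (increasing-+ i (size r) (toPerm l))))
                     (increasing-toPerm i r) ⟩
    increasing (suc i) (toPerm l) + increasing i (toPerm l) + weight i 0 r
      ≡⟨ ≡.cong (_+ weight i 0 r) (root-and-left i) ⟩
    weight i 0 (node l r) ∎
    where
    open ≡.≡-Reasoning
    root-and-left : ∀ i → increasing (suc i) (toPerm l) + increasing i (toPerm l) ≡ 0 C i + weight i 1 l
    root-and-left zero = ≡.trans (≡.cong (_+ 1) (≡.trans (increasing-toPerm 0 l) (≡.trans (weight-0 0 l) (≡.sym (weight-0 1 l)))))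
      (ℕₚ.+-comm (weight 0 1 l) 1)
    root-and-left (suc i) = ≡.trans (≡.cong₂ _+_ (increasing-toPerm (suc i) l) (increasing-toPerm i l)) (≡.sym (weight-pascal i 0 l))

  ++-∷-cancel : ∀ {m : ℕ} A B A′ B′ → m ∉ A → m ∉ A′ → A ++ m ∷ B ≡ A′ ++ m ∷ B′ → A ≡ A′ × B ≡ B′
  ++-∷-cancel [] B [] B′ _ _ e = refl , Listₚ.∷-injectiveʳ e
  ++-∷-cancel [] B (a′ ∷ A′) B′ _ m∉A′ e = ⊥-elim (m∉A′ (here (Listₚ.∷-injectiveˡ e)))
  ++-∷-cancel (a ∷ A) B [] B′ m∉A _ e = ⊥-elim (m∉A (here (≡.sym (Listₚ.∷-injectiveˡ e))))
  ++-∷-cancel (a ∷ A) B (a′ ∷ A′) B′ m∉A m∉A′ e with Listₚ.∷-injectiveˡ e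
  ... | refl with ++-∷-cancel A B A′ B′ (m∉A ∘ there) (m∉A′ ∘ there) (Listₚ.∷-injectiveʳ e)
    where open import Function using (_∘_)
  ... | refl , refl = refl , refl

  toPerm-injective : ∀ {t t′} → toPerm t ≡ toPerm t′ → t ≡ t′
  toPerm-injective {t} {t′} e = injective t t′ (≡.trans (≡.sym (length-toPerm t)) (≡.trans (≡.cong length e) (length-toPerm t′))) e
    where
    injective : ∀ t t′ → size t ≡ size t′ → toPerm t ≡ toPerm t′ → t ≡ t′
    injective leaf leaf _ _ = refl
    injective (node l r) (node l′ r′) sizes e
      with ++-∷-cancel _ (toPerm r) _ (toPerm r′) (All⇒∉ (left-below l r) (ℕₚ.<-irrefl refl))
             (All⇒∉ (left-below l′ r′) (≡.subst (λ m → ¬ m < size l′ + size r′) (≡.sym root) (ℕₚ.<-irrefl refl)))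
             (≡.subst (λ m → toPerm (node l r) ≡ map (size r′ +_) (toPerm l′) ++ m ∷ toPerm r′) (≡.sym root) e)
      where
      root : size l + size r ≡ size l′ + size r′
      root = ℕₚ.suc-injective sizes
    ... | left , right with toPerm-injective {r} {r′} right
    ... | refl = ≡.cong₂ node (toPerm-injective (Listₚ.map-injective (ℕₚ.+-cancelˡ-≡ (size r) _ _) left)) refl

  private
    Unique-++⁻ˡ : ∀ (A : List ℕ) {B} → Unique (A ++ B) → Unique A
    Unique-++⁻ˡ [] u = []
    Unique-++⁻ˡ (a ∷ A) (a∉ ∷ u) = Allₚ.++⁻ˡ A a∉ ∷ Unique-++⁻ˡ A u

    Unique-++⁻ʳ : ∀ (A : List ℕ) {B} → Unique (A ++ B) → Unique B
    Unique-++⁻ʳ [] u = u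
    Unique-++⁻ʳ (a ∷ A) (_ ∷ u) = Unique-++⁻ʳ A u

    Unique-++⁻-disjoint : ∀ (A : List ℕ) {B} → Unique (A ++ B) → ∀ {v} → v ∈ A → v ∉ B
    Unique-++⁻-disjoint (a ∷ A) (a∉ ∷ u) (here refl) = All⇒∉ (Allₚ.++⁻ʳ A a∉) (λ a≢a → a≢a refl)
    Unique-++⁻-disjoint (a ∷ A) (_ ∷ u) (there v∈A) = Unique-++⁻-disjoint A u v∈A

    map-+-∸ : ∀ c (xs : List ℕ) → All (c ≤_) xs → map (c +_) (map (_∸ c) xs) ≡ xs
    map-+-∸ c [] _ = refl
    map-+-∸ c (x ∷ xs) (c≤x ∷ c≤xs) = ≡.cong₂ _∷_ (ℕₚ.m+[n∸m]≡n c≤x) (map-+-∸ c xs c≤xs)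

  -- A 132-avoiding permutation A n B of {0,…,n} has A above B, so A and B are again such permutations.
  module Decomposition {n A B} (perm : IsPermutation (suc n) (A ++ n ∷ B)) (avoids : has132 (A ++ n ∷ B) ≡ false) where

    open IsPermutation perm

    n∉A : n ∉ A
    n∉A n∈A = Unique-++⁻-disjoint A unique n∈A (here refl)

    n∉B : n ∉ B
    n∉B = Unique-head (Unique-++⁻ʳ A unique)

    below-n : ∀ {v} → v ∈ A ++ n ∷ B → v ≢ n → v < n
    below-n v∈ v≢n = ℕₚ.≤∧≢⇒< (ℕₚ.≤-pred (All.lookup bounded v∈)) v≢n

    A<n : ∀ {a} → a ∈ A → a < n
    A<n a∈ = below-n (∈-++⁺ˡ a∈) (λ a≡n → n∉A (≡.subst (_∈ A) a≡n a∈))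

    B<n : ∀ {b} → b ∈ B → b < n
    B<n b∈ = below-n (∈-++⁺ʳ A (there b∈)) (λ b≡n → n∉B (≡.subst (_∈ B) b≡n b∈))

    B<A : ∀ {a b} → a ∈ A → b ∈ B → b < a
    B<A {a} {b} a∈ b∈ with ℕₚ.<-cmp a b
    ... | tri< a<b _ _ = ⊥-elim (no-ascent-across A n B avoids a∈ b∈ (B<n b∈) a<b)
    ... | tri≈ _ refl _ = ⊥-elim (Unique-++⁻-disjoint A unique a∈ (there b∈))
    ... | tri> _ _ b<a = b<a

    length-A+B : length A + length B ≡ n
    length-A+B = ℕₚ.suc-injective (≡.trans (≡.sym (ℕₚ.+-suc (length A) (length B))) (≡.trans (≡.sym (Listₚ.length-++ A)) length≡))

    B<length : ∀ {b} → b ∈ B → b < length B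
    B<length {b} b∈ with length B ℕ.≤? b
    ... | no B≰b = ℕₚ.≰⇒> B≰b
    ... | yes B≤b = ⊥-elim (ℕₚ.<⇒≱ (≡.subst (_≤ length B) (Listₚ.length-upTo (suc b)) (Unique-⊆⇒length≤ (Uniqueₚ.upTo⁺ (suc b)) ≤b∈B)) B≤b)
      where
      ≤b∈B : ∀ {v} → v ∈ upTo (suc b) → v ∈ B
      ≤b∈B {v} v∈ with ∈-++⁻ A (contains {v} (ℕₚ.<-trans (ℕₚ.≤-<-trans (ℕₚ.≤-pred (∈-upTo⁻ v∈)) (B<n b∈)) (ℕₚ.n<1+n n)))
      ... | inj₁ v∈A = ⊥-elim (ℕₚ.<⇒≱ (B<A v∈A b∈) (ℕₚ.≤-pred (∈-upTo⁻ v∈)))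
      ... | inj₂ (here refl) = ⊥-elim (ℕₚ.<-irrefl refl (ℕₚ.≤-<-trans (ℕₚ.≤-pred (∈-upTo⁻ v∈)) (B<n b∈)))
      ... | inj₂ (there v∈B) = v∈B

    B-permutation : IsPermutation (length B) B
    B-permutation = record { length≡ = refl ; bounded = All.tabulate B<length ; unique = Unique-tail (Unique-++⁻ʳ A unique) }

    length≤A : ∀ {a} → a ∈ A → length B ≤ a
    length≤A {a} a∈ with length B ℕ.≤? a
    ... | yes B≤a = B≤a
    ... | no B≰a = ⊥-elim (Unique-++⁻-disjoint A unique a∈ (there (IsPermutation.contains B-permutation (ℕₚ.≰⇒> B≰a))))

    A′ : List ℕ
    A′ = map (_∸ length B) A

    A≡ : map (length B +_) A′ ≡ A
    A≡ = map-+-∸ (length B) A (All.tabulate length≤A)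

    A′-permutation : IsPermutation (length A) A′
    A′-permutation = record
      { length≡ = Listₚ.length-map _ A
      ; bounded = Allₚ.map⁺ (All.tabulate (λ {a} a∈ → ≡.subst (a ∸ length B <_) (ℕₚ.m+n∸n≡m (length A) (length B))
          (ℕₚ.∸-monoˡ-< (≡.subst (a <_) (≡.sym length-A+B) (A<n a∈)) (length≤A a∈))))
      ; unique = Uniqueₚ.map⁻ (≡.subst Unique (≡.sym A≡) (Unique-++⁻ˡ A unique))
      }

    A′-avoids : has132 A′ ≡ false
    A′-avoids = ≡.trans (≡.sym (has132-+ (length B) A′)) (≡.trans (≡.cong has132 A≡) (has132-++⁻ˡ A (n ∷ B) avoids))

    B-avoids : has132 B ≡ false
    B-avoids = Boolₚ.∨-conicalʳ (has32Above n B) _ (has132-++⁻ʳ A (n ∷ B) avoids)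
      where import Data.Bool.Properties as Boolₚ

  toPerm-surjective : ∀ {n w} → IsPermutation n w → has132 w ≡ false → ∃ λ t → size t ≡ n × toPerm t ≡ w
  toPerm-surjective {n} = reconstruct n (<-wellFounded n)
    where
    open import Induction.WellFounded using (Acc; acc)
    open import Data.Nat.Induction using (<-wellFounded)
    reconstruct : ∀ n {w} → Acc _<_ n → IsPermutation n w → has132 w ≡ false → ∃ λ t → size t ≡ n × toPerm t ≡ w
    reconstruct zero {[]} _ _ _ = leaf , refl , refl
    reconstruct (suc n) {w} (acc smaller) perm avoids with ∈-∃++ (IsPermutation.contains perm (ℕₚ.n<1+n n))
    ... | A , B , refl with reconstruct (length A) (smaller A<) A′-permutation A′-avoids | reconstruct (length B) (smaller B<) B-permutation B-avoids
      where
      open Decomposition perm avoids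
      A< : length A < suc n
      A< = s≤s (≡.subst (length A ≤_) length-A+B (ℕₚ.m≤m+n _ _))
      B< : length B < suc n
      B< = s≤s (≡.subst (length B ≤_) length-A+B (ℕₚ.m≤n+m _ _))
    ... | l , size-l , toPerm-l | r , size-r , toPerm-r = node l r , ≡.cong suc sizes ,
      ≡.cong₂ _++_ (≡.trans (≡.cong₂ (λ s x → map (s +_) x) size-r toPerm-l) A≡) (≡.cong₂ _∷_ sizes toPerm-r)
      where
      open Decomposition perm avoids
      sizes : size l + size r ≡ n
      sizes = ≡.trans (≡.cong₂ _+_ size-l size-r) length-A+B

module Enumeration where

  open import Data.Bool using (Bool; T; _∧_; not)
  open import Data.Bool.Properties using (T-∧)
  open import Data.List using (List; []; _∷_; [_]; map; upTo; concatMap; filterᵇ)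
  import Data.List.Properties as Listₚ
  open import Data.List.Membership.Propositional using (_∈_; lose; find)
  open import Data.List.Membership.Propositional.Properties
    using (∈-concatMap⁺; ∈-concatMap⁻; ∈-map⁺; ∈-map⁻; ∈-upTo⁺; ∈-upTo⁻; ∈-filter⁺; ∈-filter⁻)
  open import Data.List.Membership.Propositional.Properties.WithK using (unique∧set⇒bag)
  open import Data.List.Relation.Binary.BagAndSetEquality using (∼bag⇒↭)
  open import Data.List.Relation.Binary.Permutation.Propositional using (_↭_)
  open import Data.List.Relation.Binary.Permutation.Propositional.Properties using (↭-length)
  open import Data.List.Relation.Unary.Any using (here)
  open import Data.List.Relation.Unary.AllPairs using ([]; _∷_)
  import Data.List.Relation.Unary.All as All
  open import Data.List.Relation.Unary.Unique.Propositional using (Unique)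
  import Data.List.Relation.Unary.Unique.Propositional.Properties as Uniqueₚ
  open import Data.Nat using (ℕ; zero; suc; _+_; _∸_; _≤_; s≤s; _≡ᵇ_)
  import Data.Nat.Properties as ℕₚ
  open import Data.Product using (_×_; _,_; ∃₂; proj₁; proj₂)
  open import Function using (_∘_)
  open import Function.Bundles using (Equivalence; mk⇔)
  open import Relation.Binary.PropositionalEquality as ≡ using (_≡_; refl)
  open import Relation.Nullary.Decidable using (T?)
  open import Defs using (f; perms; avoids132; occ)
  open Lists
  open Patterns
  open Trees
  open Permutations

  -- The trees of size n, generated with fuel f ≥ n.
  treesWithin : ℕ → ℕ → List Tree
  withLeftSize : ℕ → ℕ → ℕ → List Tree

  treesWithin f zero = [ leaf ]
  treesWithin zero (suc n) = []
  treesWithin (suc f) (suc n) = concatMap (withLeftSize f n) (upTo (suc n))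

  withLeftSize f n i = concatMap (λ l → map (node l) (treesWithin f (n ∸ i))) (treesWithin f i)

  trees : ℕ → List Tree
  trees n = treesWithin n n

  node-injective : ∀ {l l′ r r′} → node l r ≡ node l′ r′ → l ≡ l′ × r ≡ r′
  node-injective refl = refl , refl

  ∈withLeftSize⁻ : ∀ {f n i t} → t ∈ withLeftSize f n i →
    ∃₂ λ l r → t ≡ node l r × l ∈ treesWithin f i × r ∈ treesWithin f (n ∸ i)
  ∈withLeftSize⁻ {f} {n} {i} t∈ with find (∈-concatMap⁻ (λ l → map (node l) (treesWithin f (n ∸ i))) {xs = treesWithin f i} t∈)
  ... | l , l∈ , t∈ₗ with ∈-map⁻ (node l) t∈ₗ
  ... | r , r∈ , refl = l , r , refl , l∈ , r∈

  ∈treesWithin⁺ : ∀ f t → size t ≤ f → t ∈ treesWithin f (size t)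
  ∈treesWithin⁺ f leaf _ = here refl
  ∈treesWithin⁺ (suc f) (node l r) (s≤s l+r≤f) =
    ∈-concatMap⁺ (withLeftSize f (size l + size r)) (lose (∈-upTo⁺ (s≤s (ℕₚ.m≤m+n (size l) (size r))))
      (∈-concatMap⁺ (λ l′ → map (node l′) (treesWithin f (size l + size r ∸ size l)))
        (lose (∈treesWithin⁺ f l (ℕₚ.≤-trans (ℕₚ.m≤m+n _ _) l+r≤f))
          (∈-map⁺ (node l) (≡.subst (λ n → r ∈ treesWithin f n) (≡.sym (ℕₚ.m+n∸m≡n (size l) (size r)))
            (∈treesWithin⁺ f r (ℕₚ.≤-trans (ℕₚ.m≤n+m _ _) l+r≤f)))))))

  ∈treesWithin⁻ : ∀ f n {t} → t ∈ treesWithin f n → size t ≡ n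
  ∈treesWithin⁻ f zero (here refl) = refl
  ∈treesWithin⁻ (suc f) (suc n) t∈ with find (∈-concatMap⁻ (withLeftSize f n) {xs = upTo (suc n)} t∈)
  ... | i , i∈ , t∈ᵢ with ∈withLeftSize⁻ {f} {n} {i} t∈ᵢ
  ... | l , r , refl , l∈ , r∈ =
    ≡.cong suc (≡.trans (≡.cong₂ _+_ (∈treesWithin⁻ f i l∈) (∈treesWithin⁻ f (n ∸ i) r∈)) (ℕₚ.m+[n∸m]≡n (ℕₚ.≤-pred (∈-upTo⁻ i∈))))

  treesWithin-unique : ∀ f n → Unique (treesWithin f n)
  treesWithin-unique f zero = All.[] ∷ []
  treesWithin-unique zero (suc n) = []
  treesWithin-unique (suc f) (suc n) = Unique-concatMap _ (upTo (suc n)) (Uniqueₚ.upTo⁺ (suc n)) withLeftSize-unique same-left-size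
    where
    same-left : ∀ i l l′ t → t ∈ map (node l) (treesWithin f (n ∸ i)) → t ∈ map (node l′) (treesWithin f (n ∸ i)) → l ≡ l′
    same-left i l l′ t t∈ t∈′ with ∈-map⁻ (node l) t∈ | ∈-map⁻ (node l′) t∈′
    ... | _ , _ , refl | _ , _ , e = proj₁ (node-injective e)
    withLeftSize-unique : ∀ i → Unique (withLeftSize f n i)
    withLeftSize-unique i = Unique-concatMap _ (treesWithin f i) (treesWithin-unique f i)
      (λ l → Uniqueₚ.map⁺ (proj₂ ∘ node-injective) (treesWithin-unique f (n ∸ i))) (same-left i)
    same-left-size : ∀ i i′ t → t ∈ withLeftSize f n i → t ∈ withLeftSize f n i′ → i ≡ i′
    same-left-size i i′ t t∈ t∈′ with ∈withLeftSize⁻ {f} {n} {i} t∈ | ∈withLeftSize⁻ {f} {n} {i′} t∈′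
    ... | l , r , refl , l∈ , _ | _ , _ , e , l∈′ , _ with node-injective e
    ... | refl , refl = ≡.trans (≡.sym (∈treesWithin⁻ f i l∈)) (∈treesWithin⁻ f i′ l∈′)

  Unique-same-elements⇒↭ : ∀ {A : Set} {xs ys : List A} → Unique xs → Unique ys →
    (∀ {x} → x ∈ xs → x ∈ ys) → (∀ {x} → x ∈ ys → x ∈ xs) → xs ↭ ys
  Unique-same-elements⇒↭ ux uy xs⊆ys ys⊆xs = ∼bag⇒↭ (unique∧set⇒bag ux uy (mk⇔ xs⊆ys ys⊆xs))

  treesWithin-↭ : ∀ f n → n ≤ f → treesWithin f n ↭ trees n
  treesWithin-↭ f n n≤f = Unique-same-elements⇒↭ (treesWithin-unique f n) (treesWithin-unique n n)
    (λ {t} t∈ → ≡.subst (λ m → t ∈ trees m) (∈treesWithin⁻ f n t∈) (∈treesWithin⁺ (size t) t ℕₚ.≤-refl))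
    (λ {t} t∈ → ≡.subst (λ m → t ∈ treesWithin f m) (∈treesWithin⁻ n n t∈)
      (∈treesWithin⁺ f t (≡.subst (_≤ f) (≡.sym (∈treesWithin⁻ n n t∈)) n≤f)))

  occ-toPerm : ∀ j t → occ (suc j) (toPerm t) ≡ weight j 0 t
  occ-toPerm j t = ≡.trans (occ≡increasing (suc j) (toPerm t)) (increasing-toPerm j t)

  toPerm-counted : ∀ j r t → (avoids132 (toPerm t) ∧ (occ (suc j) (toPerm t) ≡ᵇ r)) ≡ (weight j 0 t ≡ᵇ r)
  toPerm-counted j r t = ≡.cong₂ _∧_ (≡.trans (avoids132≡not-has132 (toPerm t)) (≡.cong not (toPerm-avoids132 t)))
    (≡.cong (_≡ᵇ r) (occ-toPerm j t))

  -- toPerm maps the trees of weight r bijectively onto the permutations counted by f.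
  f≡count-trees : ∀ j n r → f n r (suc j) ≡ count (λ t → weight j 0 t ≡ᵇ r) (trees n)
  f≡count-trees j n r = ≡.trans (↭-length same-elements)
    (≡.trans (Listₚ.length-map toPerm (filterᵇ has-weight (trees n))) (length-filterᵇ has-weight (trees n)))
    where
    counted : List ℕ → Bool
    counted w = avoids132 w ∧ (occ (suc j) w ≡ᵇ r)
    has-weight : Tree → Bool
    has-weight t = weight j 0 t ≡ᵇ r
    to : ∀ {w} → w ∈ filterᵇ counted (perms n) → w ∈ map toPerm (filterᵇ has-weight (trees n))
    to {w} w∈ with ∈-filter⁻ (T? ∘ counted) {xs = perms n} w∈
    ... | w∈perms , counted-w with toPerm-surjective (∈perms⁻ {n} w∈perms) (T-avoids132⇒has132≡false w (proj₁ (Equivalence.to T-∧ counted-w)))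
    ... | t , size-t , refl = ∈-map⁺ toPerm (∈-filter⁺ (T? ∘ has-weight)
      (≡.subst (λ m → t ∈ trees m) size-t (∈treesWithin⁺ (size t) t ℕₚ.≤-refl)) (≡.subst T (toPerm-counted j r t) counted-w))
    from : ∀ {w} → w ∈ map toPerm (filterᵇ has-weight (trees n)) → w ∈ filterᵇ counted (perms n)
    from w∈ with ∈-map⁻ toPerm w∈
    ... | t , t∈ , refl with ∈-filter⁻ (T? ∘ has-weight) {xs = trees n} t∈
    ... | t∈trees , weight-t with ∈treesWithin⁻ n n t∈trees
    ... | refl = ∈-filter⁺ (T? ∘ counted) (∈perms⁺ (toPerm-isPermutation t)) (≡.subst T (≡.sym (toPerm-counted j r t)) weight-t)
    same-elements : filterᵇ counted (perms n) ↭ map toPerm (filterᵇ has-weight (trees n))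
    same-elements = Unique-same-elements⇒↭ (Uniqueₚ.filter⁺ (T? ∘ counted) (perms-unique n))
      (Uniqueₚ.map⁺ toPerm-injective (Uniqueₚ.filter⁺ (T? ∘ has-weight) (treesWithin-unique n n))) to from

module GeneratingFunctions where

  open import Data.Bool using (true; false; if_then_else_)
  open import Data.Integer as ℤ using (ℤ; +_)
  import Data.Integer.Properties as ℤₚ
  open import Data.Integer.Properties using (+-*-commutativeRing)
  open import Data.List using (List; []; _∷_; map; concatMap; upTo)
  open import Data.Nat using (ℕ; zero; suc; _+_; _∸_; _≤_; _≡ᵇ_)
  import Data.Nat.Properties as ℕₚ
  open import Data.Nat.Combinatorics using (_C_)
  open import Relation.Binary.PropositionalEquality as ≡ using (_≡_; refl)
  open import Defs using (F)
  open FormalPowerSeries using (module Transpose)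
  open Lists using (count)
  open Trees using (Tree; node; weight)
  open Enumeration using (trees; treesWithin; withLeftSize; treesWithin-↭; f≡count-trees)
  open Bivariate

  open S using (X; _^_) renaming (_✶_ to _✶ₛ_; _≋_ to _≋ₛ_)
  open Transpose +-*-commutativeRing using (ᵀ; ᵀ-cong; ᵀ-𝟙; ᵀ-X; ᵀ-ι-X^; ᵀ-✶)

  ∑ₗ-monomials : ∀ {A : Set} (L : List A) (w : A → ℕ) r → B.∑ₗ L (λ t → X ^ w t) r ≡ + count (λ t → w t ≡ᵇ r) L
  ∑ₗ-monomials [] w r = refl
  ∑ₗ-monomials (t ∷ L) w r = ≡.trans (≡.cong₂ ℤ._+_ (≡.sym (xpow≋X^ (w t) r)) (∑ₗ-monomials L w r)) (monomial (w t ≡ᵇ r))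
    where
    monomial : ∀ b → (if b then + 1 else + 0) ℤ.+ + count (λ t → w t ≡ᵇ r) L ≡ + ((if b then 1 else 0) + count (λ t → w t ≡ᵇ r) L)
    monomial true = refl
    monomial false = ℤₚ.+-identityˡ _

  module WeightEnumerator (j : ℕ) where

    -- P d n = ∑_{size t = n} q^{weight j d t}, the variable of S standing for q here.
    P : ℕ → ℕ → S.Series
    P d n = B.∑ₗ (trees n) (λ t → X ^ weight j d t)

    P-rec : ∀ d n → P d (suc n) ≋ₛ B.∑ (suc n) (λ i → X ^ (d C j) ✶ₛ (P (suc d) i ✶ₛ P d (n ∸ i)))
    P-rec d n = begin
      B.∑ₗ (concatMap (withLeftSize n n) (upTo (suc n))) g            ≈⟨ B.∑ₗ-concatMap (withLeftSize n n) (upTo (suc n)) g ⟩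
      B.∑ₗ (upTo (suc n)) (λ i → B.∑ₗ (withLeftSize n n i) g)         ≈⟨ B.∑ₗ-upTo (suc n) _ ⟩
      B.∑ (suc n) (λ i → B.∑ₗ (withLeftSize n n i) g)                 ≈⟨ B.∑-cong-< (suc n) (λ i i≤n → block-sum i (ℕₚ.≤-pred i≤n)) ⟩
      B.∑ (suc n) (λ i → X ^ c ✶ₛ (P (suc d) i ✶ₛ P d (n ∸ i))) ∎
      where
      open import Relation.Binary.Reasoning.Setoid SR.setoid
      c = d C j
      g : Tree → S.Series
      g t = X ^ weight j d t
      a b : Tree → S.Series
      a l = X ^ weight j (suc d) l
      b r = X ^ weight j d r
      g-node : ∀ l r → g (node l r) ≋ₛ X ^ c ✶ₛ (a l ✶ₛ b r)
      g-node l r = SR.trans (S.^-homo-* X (c + weight j (suc d) l) (weight j d r))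
        (SR.trans (S.✶-congʳ (b r) (S.^-homo-* X c (weight j (suc d) l))) (SR.*-assoc (X ^ c) (a l) (b r)))
      block-sum : ∀ i → i ≤ n → B.∑ₗ (withLeftSize n n i) g ≋ₛ X ^ c ✶ₛ (P (suc d) i ✶ₛ P d (n ∸ i))
      block-sum i i≤n = begin
        B.∑ₗ (withLeftSize n n i) g
          ≈⟨ B.∑ₗ-concatMap _ L g ⟩
        B.∑ₗ L (λ l → B.∑ₗ (map (node l) R) g)
          ≈⟨ B.∑ₗ-cong L (λ l → SR.trans (B.∑ₗ-map (node l) R g) (B.∑ₗ-cong R (g-node l))) ⟩
        B.∑ₗ L (λ l → B.∑ₗ R (λ r → X ^ c ✶ₛ (a l ✶ₛ b r)))
          ≈⟨ B.∑ₗ-cong L (λ l → SR.sym (SR.trans (S.✶-congˡ (X ^ c) (B.*-distribˡ-∑ₗ R (a l) b)) (B.*-distribˡ-∑ₗ R (X ^ c) _))) ⟩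
        B.∑ₗ L (λ l → X ^ c ✶ₛ (a l ✶ₛ B.∑ₗ R b))
          ≈⟨ SR.sym (SR.trans (S.✶-congˡ (X ^ c) (B.*-distribʳ-∑ₗ L (B.∑ₗ R b) a)) (B.*-distribˡ-∑ₗ L (X ^ c) _)) ⟩
        X ^ c ✶ₛ (B.∑ₗ L a ✶ₛ B.∑ₗ R b)
          ≈⟨ S.✶-congˡ (X ^ c) (S.✶-cong (B.∑ₗ-↭ a (treesWithin-↭ n i i≤n)) (B.∑ₗ-↭ b (treesWithin-↭ n (n ∸ i) (ℕₚ.m∸n≤m n i)))) ⟩
        X ^ c ✶ₛ (P (suc d) i ✶ₛ P d (n ∸ i)) ∎
        where
        L = treesWithin n i
        R = treesWithin n (n ∸ i)

    -- The same enumerators as a series in x with coefficients in ℤ[[q]].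
    Pˣ : ℕ → B.Series
    Pˣ d n = P d n

    Pˣ-rec : ∀ d → Pˣ d B.≋ B.𝟙 B.⊞ B.X B.✶ (B.ι (X ^ (d C j)) B.✶ (Pˣ (suc d) B.✶ Pˣ d))
    Pˣ-rec d zero = SR.trans (SR.+-identityʳ S.𝟙) (SR.sym (SR.trans (S.⊞-congˡ S.𝟙 (B.X✶ _ zero)) (SR.+-identityʳ S.𝟙)))
    Pˣ-rec d (suc n) = SR.trans (P-rec d n) (SR.sym (SR.trans (S.⊞-congˡ S.𝟘 (B.X✶ _ (suc n)))
      (SR.trans (SR.+-identityˡ _) (SR.trans (B.ι✶ (X ^ (d C j)) _ n)
        (SR.trans (S.✶-congˡ (X ^ (d C j)) (SR.reflexive (B.✶-unfold (Pˣ (suc d)) (Pˣ d) n))) (B.*-distribˡ-∑ (suc n) (X ^ (d C j)) _))))))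

    -- G d r n counts the trees of size n and weight r.
    G : ℕ → B.Series
    G d = ᵀ (Pˣ d)

    G-rec : ∀ d → G d B.≋ B.𝟙 B.⊞ x̂ B.✶ (B.X B.^ (d C j) B.✶ (G (suc d) B.✶ G d))
    G-rec d = BR.trans (ᵀ-cong (Pˣ-rec d)) (B.⊞-cong ᵀ-𝟙
      (BR.trans (ᵀ-✶ B.X _) (B.✶-cong ᵀ-X (BR.trans (ᵀ-✶ (B.ι (X ^ (d C j))) _) (B.✶-cong (ᵀ-ι-X^ (d C j)) (ᵀ-✶ (Pˣ (suc d)) (Pˣ d)))))))

    F≋G₀ : ∀ r → F r (suc j) ≋ₛ G 0 r
    F≋G₀ r n = ≡.trans (≡.cong +_ (f≡count-trees j n r)) (≡.sym (∑ₗ-monomials (trees n) (weight j 0) r))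

open import Data.Nat as ℕ using (ℕ; zero; suc; _+_; _*_; _≤_; _<_; NonZero)
import Data.Nat.Properties as ℕₚ
open import Data.Nat.Combinatorics using (_C_; nCk≡nC[n∸k]; nC1≡n; nCk+nC[k+1]≡[n+1]C[k+1])
open import Data.Nat.Solver using (module +-*-Solver)
open import Relation.Binary.PropositionalEquality as ≡ using (_≡_; refl)
open import Defs
open Bivariate
open Numerators using (module NumeratorSeries)
open CoefficientComparison using (module Coefficients)
open GeneratingFunctions using (module WeightEnumerator)

2*[nC2] : ∀ n → 2 * (suc n C 2) ≡ suc n * n
2*[nC2] zero = refl
2*[nC2] (suc n) = begin
  2 * (suc (suc n) C 2)                  ≡⟨ ≡.cong (2 *_) (≡.sym (nCk+nC[k+1]≡[n+1]C[k+1] (suc n) 1)) ⟩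
  2 * (suc n C 1 + suc n C 2)            ≡⟨ ℕₚ.*-distribˡ-+ 2 (suc n C 1) (suc n C 2) ⟩
  2 * (suc n C 1) + 2 * (suc n C 2)      ≡⟨ ≡.cong₂ (λ a b → 2 * a + b) (nC1≡n (suc n)) (2*[nC2] n) ⟩
  2 * suc n + suc n * n                  ≡⟨ solve 1 (λ n → con 2 :* (con 1 :+ n) :+ (con 1 :+ n) :* n := (con 2 :+ n) :* (con 1 :+ n)) refl n ⟩
  suc (suc n) * suc n                    ∎
  where
  open ≡.≡-Reasoning
  open +-*-Solver

-- The hypothesis r ≤ k(k+3)/2 says r ≤ k + C(k+1, 2).
range : ∀ j p → 2 * suc p ≤ suc j * (suc j + 3) → p < suc j + (suc (suc j) C j)
range j p bound = ℕₚ.*-cancelˡ-≤ 2 (≡.subst (2 * suc p ≤_) k[k+3]≡2[k+M] bound)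
  where
  open +-*-Solver
  M≡ : suc (suc j) C j ≡ suc (suc j) C 2
  M≡ = ≡.trans (nCk≡nC[n∸k] (ℕₚ.≤-trans (ℕₚ.n≤1+n j) (ℕₚ.n≤1+n (suc j)))) (≡.cong (suc (suc j) C_) (ℕₚ.m+n∸n≡m 2 j))
  k[k+3]≡2[k+M] : suc j * (suc j + 3) ≡ 2 * (suc j + suc (suc j) C j)
  k[k+3]≡2[k+M] = begin
    suc j * (suc j + 3)                   ≡⟨ solve 1 (λ j → (con 1 :+ j) :* ((con 1 :+ j) :+ con 3) := con 2 :* (con 1 :+ j) :+ (con 2 :+ j) :* (con 1 :+ j)) refl j ⟩
    2 * suc j + suc (suc j) * suc j       ≡⟨ ≡.cong (λ m → 2 * suc j + m) (≡.sym (≡.trans (≡.cong (2 *_) M≡) (2*[nC2] (suc j)))) ⟩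
    2 * suc j + 2 * (suc (suc j) C j)     ≡⟨ ≡.sym (ℕₚ.*-distribˡ-+ 2 (suc j) _) ⟩
    2 * (suc j + suc (suc j) C j)         ∎
    where open ≡.≡-Reasoning

theorem4p1 : (k : ℕ) → .{{_ : NonZero k}} → (r : ℕ) → 1 ≤ r → 2 * r ≤ k * (k + 3) →
    ∀ n → ((R k ^ˢ (r + 1)) ⊛ F r k) n ≡ numer r k n
theorem4p1 k zero () bound n
theorem4p1 zero (suc p) _ ()
theorem4p1 (suc j) (suc p) _ bound n = begin
  ((R k ^ˢ (suc p + 1)) ⊛ F (suc p) k) n   ≡⟨ ⊛≋✶ _ _ n ⟩
  (R k ^ˢ (suc p + 1) S.✶ F (suc p) k) n   ≡⟨ S.✶-cong (SR.trans (^ˢ≋^ (R k) (suc p + 1)) (SR.reflexive (≡.cong (R k S.^_) (ℕₚ.+-comm (suc p) 1))))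
                                                        (F≋G₀ (suc p)) n ⟩
  (R k S.^ suc (suc p) S.✶ G 0 (suc p)) n  ≡⟨ numerator-coefficient p (range j p bound) n ⟩
  numerator p n                            ≡⟨ ≡.sym (numer≋numerator p n) ⟩
  numer (suc p) k n                        ∎
  where
  k = suc j
  open WeightEnumerator j using (G; G-rec; F≋G₀)
  open Coefficients j G G-rec using (numerator-coefficient)
  open NumeratorSeries j using (numerator; numer≋numerator)
  open ≡.≡-Reasoning
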